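{- Let $n\ge 3$ be an integer, and let $\mathcal{M}_n$, $\mathcal{G}_n$, $\Phi_n$ and $\Psi_n$ be as defined in the context. Then $\Phi_n$ maps $\mathcal{M}_n$ into $\mathcal{G}_n$, $\Psi_n$ maps $\mathcal{G}_n$ into $\mathcal{M}_n$, and $\Phi_n:\mathcal{M}_n\to\mathcal{G}_n$ and $\Psi_n:\mathcal{G}_n\to\mathcal{M}_n$ are bijections which are inverse to each other, i.e. $\Psi_n\circ\Phi_n$ is the identity on $\mathcal{M}_n$ and $\Phi_n\circ\Psi_n$ is the identity on $\mathcal{G}_n$.
   Context: Fix an integer $n\ge 3$. An $(n,2)$-Magog trapezoid is an array of $2n-1$ positive integers $m_{1,1},\ldots,m_{1,n-1},m_{2,1},\ldots,m_{2,n}$ such that: (i) $m_{i,j}\le m_{i,j+1}$ for all $i\in\{1,2\}$ and $j\in\{1,\ldots,n+i-3\}$; (ii) $m_{1,j}\le m_{2,j}\le j$ for all $j\in\{1,\ldots,n-1\}$, and $m_{2,n}\le n$. The set of these is $\mathcal{M}_n$. An $(n,2)$-Gog trapezoid is an array of $2n-1$ positive integers $g_{1,1},\ldots,g_{1,n},g_{2,1},\ldots,g_{2,n-1}$ such that: (i) $g_{i,j}\le g_{i,j+1}$ for all $i\in\{1,2\}$ and $j\in\{1,\ldots,n-i\}$; (ii) $g_{1,j}<g_{2,j}<j+2$ for all $j\in\{1,\ldots,n-1\}$; (iii) $g_{1,j+1}\le g_{2,j}$ for all $j\in\{1,\ldots,n-1\}$. The set of these is $\mathcal{G}_n$. The map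 $\Phi_n$. For a Magog trapezoid $M=(m_{i,j})$, an integer $j\in\{1,\ldots,n-2\}$ is called a bug if $m_{1,j+1}>m_{2,j}+1$. Define $\Phi_n(M)=(g_{i,j})$ (with $g_{1,1},\dots,g_{1,n}$ and $g_{2,1},\dots,g_{2,n-1}$) as follows. Case 1 ($M$ has at least one bug; let $k$ be the smallest bug): $g_{2,j}=m_{2,j}+1$ for $1\le j\le k-1$; $g_{2,j}=m_{2,j+1}$ for $k\le j\le n-1$; $g_{1,j}=m_{1,j}$ for $1\le j\le k$; $g_{1,k+1}=m_{2,k}$; $g_{1,j}=m_{1,j-1}-2$ for $k+2\le j\le n$. Case 2 ($M$ has no bug and $m_{2,n-1}<m_{2,n}$): $g_{2,j}=m_{2,j}+1$ for $1\le j\le n-2$; $g_{2,n-1}=m_{2,n}$; $g_{1,j}=m_{1,j}$ for $1\le j\le n-1$; $g_{1,n}=m_{2,n-1}$. Case 3 ($M$ has no bug and $m_{2,n-1}=m_{2,n}$): $g_{2,j}=m_{2,j}+1$ for $1\le j\le n-1$; $g_{1,j}=m_{1,j}$ for $1\le j\le n-1$; $g_{1,n}=m_{2,n}+1$. The map $\Psi_n$. For a Gog trapezoid $G=(g_{i,j})$, let $k=\max\{j\in\{2,\ldots,n-1\}: g_{2,j-1}\le g_{1,j+1}+1\}$. Define $\Psi_n(G)=(m_{i,j})$ (with $m_{1,1},\dots,m_{1,n-1}$ and $m_{2,1},\dots,m_{2,n}$) as follows. Case 1 ($k\le n-2$): $m_{2,j}=g_{2,j}-1$ for $1\le j\le k-1$;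 $m_{2,k}=g_{1,k+1}$; $m_{2,j}=g_{2,j-1}$ for $k+1\le j\le n$; $m_{1,j}=g_{1,j}$ for $1\le j\le k$; $m_{1,j}=g_{1,j+1}+2$ for $k+1\le j\le n-1$. Case 2 ($k=n-1$ and $g_{1,n}<g_{2,n-1}$): $m_{2,j}=g_{2,j}-1$ for $1\le j\le n-2$; $m_{2,n-1}=g_{1,n}$; $m_{2,n}=g_{2,n-1}$; $m_{1,j}=g_{1,j}$ for $1\le j\le n-1$. Case 3 ($k=n-1$ and $g_{1,n}=g_{2,n-1}$): $m_{2,j}=g_{2,j}-1$ for $1\le j\le n-1$; $m_{2,n}=g_{1,n}-1$; $m_{1,j}=g_{1,j}$ for $1\le j\le n-1$. -}

module Defs where

open import Data.Nat using (ℕ; zero; suc; _+_; _∸_; _≤_; _<_; _≤ᵇ_; _<ᵇ_; _≡ᵇ_)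
open import Data.Bool using (Bool; true; false; if_then_else_)
open import Data.Maybe using (Maybe; just; nothing)
open import Data.Fin using (Fin; toℕ; fromℕ<)
open import Data.Vec using (Vec; lookup; tabulate)
open import Data.Product using (_×_; _,_)
open import Relation.Nullary.Decidable using (yes; no)
open import Data.Nat.Properties using (_<?_)

-- v ! j  is the j-th entry (1-based) of v; 0 when j is out of range
-- (only used at in-range indices below).
_!_ : ∀ {k} → Vec ℕ k → ℕ → ℕ
_!_ {k} v zero = 0
_!_ {k} v (suc i) with i <? k
... | yes p = lookup v (fromℕ< p)
... | no _  = 0

build : (k : ℕ) → (ℕ → ℕ) → Vec ℕ k
build k f = tabulate (λ i → f (suc (toℕ i)))

-- (n,2)-Magog trapezoids: first row m_{1,1..n-1}, second row m_{2,1..n}.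

Magog : ℕ → Set
Magog n = Vec ℕ (n ∸ 1) × Vec ℕ n

record IsMagog (n : ℕ) (M : Magog n) : Set where
  constructor isMagog
  field
    pos₁  : ∀ j → 1 ≤ j → j ≤ n ∸ 1 → 1 ≤ (Data.Product.proj₁ M) ! j
    pos₂  : ∀ j → 1 ≤ j → j ≤ n → 1 ≤ (Data.Product.proj₂ M) ! j
    mono₁ : ∀ j → 1 ≤ j → j ≤ n ∸ 2 →
              (Data.Product.proj₁ M) ! j ≤ (Data.Product.proj₁ M) ! (suc j)
    mono₂ : ∀ j → 1 ≤ j → j ≤ n ∸ 1 →
              (Data.Product.proj₂ M) ! j ≤ (Data.Product.proj₂ M) ! (suc j)
    col   : ∀ j → 1 ≤ j → j ≤ n ∸ 1 →
              (Data.Product.proj₁ M) ! j ≤ (Data.Product.proj₂ M) ! j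
    bnd   : ∀ j → 1 ≤ j → j ≤ n ∸ 1 → (Data.Product.proj₂ M) ! j ≤ j
    bndₙ  : (Data.Product.proj₂ M) ! n ≤ n

-- (n,2)-Gog trapezoids: first row g_{1,1..n}, second row g_{2,1..n-1}.

Gog : ℕ → Set
Gog n = Vec ℕ n × Vec ℕ (n ∸ 1)

record IsGog (n : ℕ) (G : Gog n) : Set where
  constructor isGog
  field
    pos₁  : ∀ j → 1 ≤ j → j ≤ n → 1 ≤ (Data.Product.proj₁ G) ! j
    pos₂  : ∀ j → 1 ≤ j → j ≤ n ∸ 1 → 1 ≤ (Data.Product.proj₂ G) ! j
    mono₁ : ∀ j → 1 ≤ j → j ≤ n ∸ 1 →
              (Data.Product.proj₁ G) ! j ≤ (Data.Product.proj₁ G) ! (suc j)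
    mono₂ : ∀ j → 1 ≤ j → j ≤ n ∸ 2 →
              (Data.Product.proj₂ G) ! j ≤ (Data.Product.proj₂ G) ! (suc j)
    col   : ∀ j → 1 ≤ j → j ≤ n ∸ 1 →
              (Data.Product.proj₁ G) ! j < (Data.Product.proj₂ G) ! j
    bnd   : ∀ j → 1 ≤ j → j ≤ n ∸ 1 → (Data.Product.proj₂ G) ! j < j + 2
    diag  : ∀ j → 1 ≤ j → j ≤ n ∸ 1 →
              (Data.Product.proj₁ G) ! (suc j) ≤ (Data.Product.proj₂ G) ! j

first : (ℕ → Bool) → ℕ → ℕ → Maybe ℕ
first p j zero    = nothing
first p j (suc c) = if p j then just j else first p (suc j) c

lastDown : (ℕ → Bool) → ℕ → ℕ → ℕ
lastDown p zero    d = d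
lastDown p (suc j) d =
  if suc j <ᵇ d then d
  else (if p (suc j) then suc j else lastDown p j d)

smallestBug : (n : ℕ) → Magog n → Maybe ℕ
smallestBug n (r₁ , r₂) =
  first (λ j → suc (r₂ ! j) <ᵇ r₁ ! (suc j)) 1 (n ∸ 2)

Φ : (n : ℕ) → Magog n → Gog n
Φ n (r₁ , r₂) with smallestBug n (r₁ , r₂)
... | just k =
  build n (λ j → if j ≤ᵇ k then m₁ j
                 else (if j ≡ᵇ suc k then m₂ k else m₁ (j ∸ 1) ∸ 2)) ,
  build (n ∸ 1) (λ j → if j ≤ᵇ k ∸ 1 then m₂ j + 1 else m₂ (suc j))
  where m₁ = r₁ !_ ; m₂ = r₂ !_
... | nothing =
  if r₂ ! (n ∸ 1) <ᵇ r₂ ! n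
  then ( build n (λ j → if j ≤ᵇ n ∸ 1 then r₁ ! j else r₂ ! (n ∸ 1))
       , build (n ∸ 1) (λ j → if j ≤ᵇ n ∸ 2 then r₂ ! j + 1 else r₂ ! n) )
  else ( build n (λ j → if j ≤ᵇ n ∸ 1 then r₁ ! j else r₂ ! n + 1)
       , build (n ∸ 1) (λ j → r₂ ! j + 1) )

-- k = max { j ∈ {2,…,n-1} : g_{2,j-1} ≤ g_{1,j+1} + 1 }
-- (this set always contains 2 for a Gog trapezoid; default 2)
ψk : (n : ℕ) → Gog n → ℕ
ψk n (r₁ , r₂) = lastDown (λ j → r₂ ! (j ∸ 1) ≤ᵇ r₁ ! (suc j) + 1) (n ∸ 1) 2

Ψ : (n : ℕ) → Gog n → Magog n
Ψ n (r₁ , r₂) =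
  if k ≤ᵇ n ∸ 2
  then ( build (n ∸ 1) (λ j → if j ≤ᵇ k then g₁ j else g₁ (suc j) + 2)
       , build n (λ j → if j ≤ᵇ k ∸ 1 then g₂ j ∸ 1
                        else (if j ≡ᵇ k then g₁ (suc k) else g₂ (j ∸ 1))) )
  else (if g₁ n <ᵇ g₂ (n ∸ 1)
        then ( build (n ∸ 1) g₁
             , build n (λ j → if j ≤ᵇ n ∸ 2 then g₂ j ∸ 1
                              else (if j ≡ᵇ n ∸ 1 then g₁ n else g₂ (n ∸ 1))) )
        else ( build (n ∸ 1) g₁
             , build n (λ j → if j ≤ᵇ n ∸ 1 then g₂ j ∸ 1 else g₁ n ∸ 1) ))
  where
  k = ψk n (r₁ , r₂)
  g₁ = r₁ !_
  g₂ = r₂ !_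

module Submission where

-- For Ψ ∘ Φ = id the key point is
-- that the search of Ψ run on Φ(M) stops exactly at the smallest bug of M;
-- symmetrically, the smallest bug of Ψ(G) is the column k chosen by Ψ.

open import Defs
open import Data.Nat using (ℕ; _≤_)
open import Data.Product using (_×_)
open import Relation.Binary.PropositionalEquality using (_≡_)

open import Data.Nat using (zero; suc; _+_; _∸_; _<_; s≤s; z≤n; _≤ᵇ_; _<ᵇ_; _≡ᵇ_)
open import Data.Nat.Properties
open import Data.Bool using (Bool; true; false; if_then_else_; T)
open import Data.Unit using (tt)
open import Data.Empty using (⊥-elim)
open import Data.Maybe using (just; nothing)
open import Data.Fin using (Fin; toℕ; fromℕ<)
open import Data.Fin.Properties using (toℕ<n; fromℕ<-toℕ; toℕ-fromℕ<)
open import Data.Vec using (Vec; lookup)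
open import Data.Vec.Properties using (lookup∘tabulate; tabulate∘lookup; tabulate-cong)
open import Data.Product using (_,_)
open import Data.Sum using (_⊎_; inj₁; inj₂)
open import Relation.Nullary using (¬_; yes; no)
open import Relation.Binary.PropositionalEquality
  using (_≢_; refl; sym; trans; cong; cong₂; subst; module ≡-Reasoning)

if-true : ∀ {A : Set} {b} {x y : A} → b ≡ true → (if b then x else y) ≡ x
if-true refl = refl

if-false : ∀ {A : Set} {b} {x y : A} → b ≡ false → (if b then x else y) ≡ y
if-false refl = refl

T⇒≡true : ∀ {b} → T b → b ≡ true
T⇒≡true {true} _ = refl

¬T⇒≡false : ∀ {b} → ¬ T b → b ≡ false
¬T⇒≡false {true}  ¬t = ⊥-elim (¬t tt)
¬T⇒≡false {false} _  = refl

≡true⇒T : ∀ {b} → b ≡ true → T b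
≡true⇒T refl = tt

≤ᵇ-yes : ∀ {j k} → j ≤ k → (j ≤ᵇ k) ≡ true
≤ᵇ-yes j≤k = T⇒≡true (≤⇒≤ᵇ j≤k)

≤ᵇ-no : ∀ {j k} → k < j → (j ≤ᵇ k) ≡ false
≤ᵇ-no {j} {k} k<j = ¬T⇒≡false (λ t → <⇒≱ k<j (≤ᵇ⇒≤ j k t))

<ᵇ-yes : ∀ {j k} → j < k → (j <ᵇ k) ≡ true
<ᵇ-yes j<k = T⇒≡true (<⇒<ᵇ j<k)

<ᵇ-no : ∀ {j k} → k ≤ j → (j <ᵇ k) ≡ false
<ᵇ-no {j} {k} k≤j = ¬T⇒≡false (λ t → ≤⇒≯ k≤j (<ᵇ⇒< j k t))

≡ᵇ-yes : ∀ j → (j ≡ᵇ j) ≡ true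
≡ᵇ-yes j = T⇒≡true (≡⇒≡ᵇ j j refl)

≡ᵇ-no : ∀ {j k} → j ≢ k → (j ≡ᵇ k) ≡ false
≡ᵇ-no {j} {k} j≢k = ¬T⇒≡false (λ t → j≢k (≡ᵇ⇒≡ j k t))

≤ᵇ-true⇒≤ : ∀ {j k} → (j ≤ᵇ k) ≡ true → j ≤ k
≤ᵇ-true⇒≤ {j} {k} e = ≤ᵇ⇒≤ j k (≡true⇒T e)

≤ᵇ-false⇒> : ∀ {j k} → (j ≤ᵇ k) ≡ false → k < j
≤ᵇ-false⇒> e = ≰⇒> (λ j≤k → subst T e (≤⇒≤ᵇ j≤k))

<ᵇ-true⇒< : ∀ {j k} → (j <ᵇ k) ≡ true → j < k
<ᵇ-true⇒< {j} {k} e = <ᵇ⇒< j k (≡true⇒T e)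

<ᵇ-false⇒≥ : ∀ {j k} → (j <ᵇ k) ≡ false → k ≤ j
<ᵇ-false⇒≥ e = ≮⇒≥ (λ j<k → subst T e (<⇒<ᵇ j<k))

!-lookup : ∀ {k} (v : Vec ℕ k) (i : Fin k) → v ! suc (toℕ i) ≡ lookup v i
!-lookup {k} v i with toℕ i <? k
... | yes p = cong (lookup v) (fromℕ<-toℕ i p)
... | no ¬p = ⊥-elim (¬p (toℕ<n i))

!-build : ∀ k f j → 1 ≤ j → j ≤ k → build k f ! j ≡ f j
!-build k f (suc i) _ i<k with i <? k
... | yes p = trans (lookup∘tabulate _ (fromℕ< p)) (cong (λ x → f (suc x)) (toℕ-fromℕ< p))
... | no ¬p = ⊥-elim (¬p i<k)

build-ext : ∀ k f (v : Vec ℕ k) → (∀ j → 1 ≤ j → j ≤ k → f j ≡ v ! j) → build k f ≡ v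
build-ext k f v f≗v =
  trans (tabulate-cong (λ i → trans (f≗v (suc (toℕ i)) (s≤s z≤n) (toℕ<n i)) (!-lookup v i)))
        (tabulate∘lookup v)

≤-via : ∀ {a a′ b b′} → a ≡ a′ → b ≡ b′ → a′ ≤ b′ → a ≤ b
≤-via refl refl a′≤b′ = a′≤b′

<-via : ∀ {a a′ b b′} → a ≡ a′ → b ≡ b′ → a′ < b′ → a < b
<-via refl refl a′<b′ = a′<b′

isGog-build : ∀ p (f₁ f₂ : ℕ → ℕ) →
  (∀ j → 1 ≤ j → j ≤ 3 + p → 1 ≤ f₁ j) →
  (∀ j → 1 ≤ j → j ≤ 2 + p → 1 ≤ f₂ j) →
  (∀ j → 1 ≤ j → j ≤ 2 + p → f₁ j ≤ f₁ (suc j)) →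
  (∀ j → 1 ≤ j → j ≤ 1 + p → f₂ j ≤ f₂ (suc j)) →
  (∀ j → 1 ≤ j → j ≤ 2 + p → f₁ j < f₂ j) →
  (∀ j → 1 ≤ j → j ≤ 2 + p → f₂ j < j + 2) →
  (∀ j → 1 ≤ j → j ≤ 2 + p → f₁ (suc j) ≤ f₂ j) →
  IsGog (3 + p) (build (3 + p) f₁ , build (2 + p) f₂)
isGog-build p f₁ f₂ pos₁ pos₂ mono₁ mono₂ col bnd diag = isGog
  (λ j a b → ≤-via refl (row₁ j a b) (pos₁ j a b))
  (λ j a b → ≤-via refl (row₂ j a b) (pos₂ j a b))
  (λ j a b → ≤-via (row₁ j a (m≤n⇒m≤1+n b)) (row₁ (suc j) (s≤s z≤n) (s≤s b)) (mono₁ j a b))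
  (λ j a b → ≤-via (row₂ j a (m≤n⇒m≤1+n b)) (row₂ (suc j) (s≤s z≤n) (s≤s b)) (mono₂ j a b))
  (λ j a b → <-via (row₁ j a (m≤n⇒m≤1+n b)) (row₂ j a b) (col j a b))
  (λ j a b → <-via (row₂ j a b) refl (bnd j a b))
  (λ j a b → ≤-via (row₁ (suc j) (s≤s z≤n) (s≤s b)) (row₂ j a b) (diag j a b))
  where
  row₁ : ∀ j → 1 ≤ j → j ≤ 3 + p → build (3 + p) f₁ ! j ≡ f₁ j
  row₁ = !-build (3 + p) f₁
  row₂ : ∀ j → 1 ≤ j → j ≤ 2 + p → build (2 + p) f₂ ! j ≡ f₂ j
  row₂ = !-build (2 + p) f₂

isMagog-build : ∀ p (f₁ f₂ : ℕ → ℕ) →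
  (∀ j → 1 ≤ j → j ≤ 2 + p → 1 ≤ f₁ j) →
  (∀ j → 1 ≤ j → j ≤ 3 + p → 1 ≤ f₂ j) →
  (∀ j → 1 ≤ j → j ≤ 1 + p → f₁ j ≤ f₁ (suc j)) →
  (∀ j → 1 ≤ j → j ≤ 2 + p → f₂ j ≤ f₂ (suc j)) →
  (∀ j → 1 ≤ j → j ≤ 2 + p → f₁ j ≤ f₂ j) →
  (∀ j → 1 ≤ j → j ≤ 2 + p → f₂ j ≤ j) →
  f₂ (3 + p) ≤ 3 + p →
  IsMagog (3 + p) (build (2 + p) f₁ , build (3 + p) f₂)
isMagog-build p f₁ f₂ pos₁ pos₂ mono₁ mono₂ col bnd bndₙ = isMagog
  (λ j a b → ≤-via refl (row₁ j a b) (pos₁ j a b))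
  (λ j a b → ≤-via refl (row₂ j a b) (pos₂ j a b))
  (λ j a b → ≤-via (row₁ j a (m≤n⇒m≤1+n b)) (row₁ (suc j) (s≤s z≤n) (s≤s b)) (mono₁ j a b))
  (λ j a b → ≤-via (row₂ j a (m≤n⇒m≤1+n b)) (row₂ (suc j) (s≤s z≤n) (s≤s b)) (mono₂ j a b))
  (λ j a b → ≤-via (row₁ j a b) (row₂ j a (m≤n⇒m≤1+n b)) (col j a b))
  (λ j a b → ≤-via (row₂ j a (m≤n⇒m≤1+n b)) refl (bnd j a b))
  (≤-via (row₂ (3 + p) (s≤s z≤n) ≤-refl) refl bndₙ)
  where
  row₁ : ∀ j → 1 ≤ j → j ≤ 2 + p → build (2 + p) f₁ ! j ≡ f₁ j
  row₁ = !-build (2 + p) f₁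
  row₂ : ∀ j → 1 ≤ j → j ≤ 3 + p → build (3 + p) f₂ ! j ≡ f₂ j
  row₂ = !-build (3 + p) f₂

first-just⇒ : ∀ p j c k → first p j c ≡ just k →
  j ≤ k × k < j + c × p k ≡ true × (∀ i → j ≤ i → i < k → p i ≡ false)
first-just⇒ p j zero k ()
first-just⇒ p j (suc c) k e with p j in pj
... | true with e
...   | refl = ≤-refl , subst (j <_) (sym (+-suc j c)) (s≤s (m≤m+n j c)) , pj ,
               λ i j≤i i<j → ⊥-elim (<⇒≱ i<j j≤i)
first-just⇒ p j (suc c) k e | false with first-just⇒ p (suc j) c k e
... | j<k , k<end , pk , below = <⇒≤ j<k , subst (k <_) (sym (+-suc j c)) k<end , pk , below′
  where
  below′ : ∀ i → j ≤ i → i < k → p i ≡ false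
  below′ i j≤i i<k with m≤n⇒m<n∨m≡n j≤i
  ... | inj₁ j<i  = below i j<i i<k
  ... | inj₂ refl = pj

first-nothing⇒ : ∀ p j c → first p j c ≡ nothing → ∀ i → j ≤ i → i < j + c → p i ≡ false
first-nothing⇒ p j zero e i j≤i i<j = ⊥-elim (<⇒≱ i<j (subst (_≤ i) (sym (+-identityʳ j)) j≤i))
first-nothing⇒ p j (suc c) e i j≤i i<end with p j in pj
first-nothing⇒ p j (suc c) () i j≤i i<end | true
... | false with m≤n⇒m<n∨m≡n j≤i
... | inj₁ j<i  = first-nothing⇒ p (suc j) c e i j<i (subst (i <_) (+-suc j c) i<end)
... | inj₂ refl = pj

first-finds : ∀ p j c k → p k ≡ true → j ≤ k → k < j + c →
  (∀ i → j ≤ i → i < k → p i ≡ false) → first p j c ≡ just k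
first-finds p j zero k pk j≤k k<j _ = ⊥-elim (<⇒≱ k<j (subst (_≤ k) (sym (+-identityʳ j)) j≤k))
first-finds p j (suc c) k pk j≤k k<end below with m≤n⇒m<n∨m≡n j≤k
... | inj₂ refl rewrite pk = refl
... | inj₁ j<k rewrite below j ≤-refl j<k =
  first-finds p (suc j) c k pk j<k (subst (k <_) (+-suc j c) k<end) (λ i j<i i<k → below i (<⇒≤ j<i) i<k)

first-fails : ∀ p j c → (∀ i → j ≤ i → i < j + c → p i ≡ false) → first p j c ≡ nothing
first-fails p j zero _ = refl
first-fails p j (suc c) none rewrite none j ≤-refl (subst (j <_) (sym (+-suc j c)) (s≤s (m≤m+n j c))) =
  first-fails p (suc j) c (λ i j<i i<end → none i (<⇒≤ j<i) (subst (i <_) (sym (+-suc j c)) i<end))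

lastDown-below : ∀ p j d → j < d → lastDown p j d ≡ d
lastDown-below p zero    d _   = refl
lastDown-below p (suc j) d j<d rewrite <ᵇ-yes j<d = refl

lastDown-spec : ∀ p j d → d ≤ j →
  let k = lastDown p j d in
  d ≤ k × k ≤ j × (k ≡ d ⊎ p k ≡ true) × (∀ i → k < i → i ≤ j → p i ≡ false)
lastDown-spec p zero .zero z≤n = z≤n , z≤n , inj₁ refl , λ i k<i i≤k → ⊥-elim (<⇒≱ k<i i≤k)
lastDown-spec p (suc j) d d≤j rewrite <ᵇ-no {suc j} {d} d≤j with p (suc j) in pj
... | true = d≤j , ≤-refl , inj₂ pj , λ i k<i i≤k → ⊥-elim (<⇒≱ k<i i≤k)
... | false with m≤n⇒m<n∨m≡n d≤j
...   | inj₂ refl rewrite lastDown-below p j (suc j) ≤-refl =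
          ≤-refl , ≤-refl , inj₁ refl , λ i k<i i≤k → ⊥-elim (<⇒≱ k<i i≤k)
...   | inj₁ d<j with lastDown-spec p j d (≤-pred d<j)
...     | d≤k , k≤j , witness , above = d≤k , m≤n⇒m≤1+n k≤j , witness , above′
  where
  above′ : ∀ i → lastDown p j d < i → i ≤ suc j → p i ≡ false
  above′ i k<i i≤j with m≤n⇒m<n∨m≡n i≤j
  ... | inj₁ i<j  = above i k<i (≤-pred i<j)
  ... | inj₂ refl = pj

lastDown-finds : ∀ p j d k → d ≤ k → k ≤ j → p k ≡ true →
  (∀ i → k < i → i ≤ j → p i ≡ false) → lastDown p j d ≡ k
lastDown-finds p zero d .zero z≤n z≤n _ _ = refl
lastDown-finds p (suc j) d k d≤k k≤j pk above rewrite <ᵇ-no {suc j} {d} (≤-trans d≤k k≤j)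
  with m≤n⇒m<n∨m≡n k≤j
... | inj₂ refl rewrite pk = refl
... | inj₁ k<j rewrite above (suc j) k<j ≤-refl =
  lastDown-finds p j d k d≤k (≤-pred k<j) pk (λ i k<i i≤j → above i k<i (m≤n⇒m≤1+n i≤j))

data Around (k : ℕ) : ℕ → Set where
  before : ∀ {j} → j ≤ k → Around k j
  next   : Around k (suc k)
  beyond : ∀ {i} → suc k ≤ i → Around k (suc i)

around : ∀ k j → Around k j
around k j with ≤-<-connex j k
... | inj₁ j≤k = before j≤k
around k (suc i) | inj₂ (s≤s k≤i) with m≤n⇒m<n∨m≡n k≤i
... | inj₁ k<i  = beyond k<i
... | inj₂ refl = next

data UpTo (N : ℕ) : ℕ → Set where
  inner : ∀ {j} → j ≤ N → UpTo N j
  last  : UpTo N (suc N)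

upTo : ∀ N j → j ≤ suc N → UpTo N j
upTo N j j≤N+1 with m≤n⇒m<n∨m≡n j≤N+1
... | inj₁ j<N+1 = inner (≤-pred j<N+1)
... | inj₂ refl  = last

stepwise-mono : (f : ℕ → ℕ) (a b : ℕ) → (∀ j → a ≤ j → j < b → f j ≤ f (suc j)) →
  ∀ i j → a ≤ i → i ≤ j → j ≤ b → f i ≤ f j
stepwise-mono f a b step i zero    a≤i z≤n   _   = ≤-refl
stepwise-mono f a b step i (suc j) a≤i i≤j+1 j<b with m≤n⇒m<n∨m≡n i≤j+1
... | inj₂ refl = ≤-refl
... | inj₁ i≤j  = ≤-trans (stepwise-mono f a b step i j a≤i (≤-pred i≤j) (<⇒≤ j<b))
                          (step j (≤-trans a≤i (≤-pred i≤j)) j<b)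

φbug₁ : ℕ → (ℕ → ℕ) → (ℕ → ℕ) → ℕ → ℕ
φbug₁ k m₁ m₂ j = if j ≤ᵇ k then m₁ j else (if j ≡ᵇ suc k then m₂ k else m₁ (j ∸ 1) ∸ 2)

φbug₂ : ℕ → (ℕ → ℕ) → ℕ → ℕ
φbug₂ k m₂ j = if j ≤ᵇ k ∸ 1 then m₂ j + 1 else m₂ (suc j)

φbug₁-before : ∀ k m₁ m₂ {j} → j ≤ k → φbug₁ k m₁ m₂ j ≡ m₁ j
φbug₁-before k m₁ m₂ j≤k = if-true (≤ᵇ-yes j≤k)

φbug₁-next : ∀ k m₁ m₂ → φbug₁ k m₁ m₂ (suc k) ≡ m₂ k
φbug₁-next k m₁ m₂ = trans (if-false (≤ᵇ-no {suc k} {k} ≤-refl)) (if-true (≡ᵇ-yes (suc k)))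

φbug₁-beyond : ∀ k m₁ m₂ {i} → suc k ≤ i → φbug₁ k m₁ m₂ (suc i) ≡ m₁ i ∸ 2
φbug₁-beyond k m₁ m₂ {i} k<i =
  trans (if-false (≤ᵇ-no {suc i} {k} (s≤s (<⇒≤ k<i))))
        (if-false (≡ᵇ-no (λ e → <⇒≢ k<i (sym (suc-injective e)))))

φbug₂-before : ∀ k m₂ {j} → j ≤ k → φbug₂ (suc k) m₂ j ≡ m₂ j + 1
φbug₂-before k m₂ j≤k = if-true (≤ᵇ-yes j≤k)

φbug₂-from : ∀ k m₂ {j} → k < j → φbug₂ (suc k) m₂ j ≡ m₂ (suc j)
φbug₂-from k m₂ k<j = if-false (≤ᵇ-no k<j)

φrise₁ : ℕ → (ℕ → ℕ) → (ℕ → ℕ) → ℕ → ℕ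
φrise₁ p m₁ m₂ j = if j ≤ᵇ 2 + p then m₁ j else m₂ (2 + p)

φrise₂ : ℕ → (ℕ → ℕ) → ℕ → ℕ
φrise₂ p m₂ j = if j ≤ᵇ 1 + p then m₂ j + 1 else m₂ (3 + p)

φflat₁ : ℕ → (ℕ → ℕ) → (ℕ → ℕ) → ℕ → ℕ
φflat₁ p m₁ m₂ j = if j ≤ᵇ 2 + p then m₁ j else m₂ (3 + p) + 1

φflat₂ : (ℕ → ℕ) → ℕ → ℕ
φflat₂ m₂ j = m₂ j + 1

φrise₁-inner : ∀ p m₁ m₂ {j} → j ≤ 2 + p → φrise₁ p m₁ m₂ j ≡ m₁ j
φrise₁-inner p m₁ m₂ j≤ = if-true (≤ᵇ-yes j≤)

φrise₁-last : ∀ p m₁ m₂ → φrise₁ p m₁ m₂ (3 + p) ≡ m₂ (2 + p)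
φrise₁-last p m₁ m₂ = if-false (≤ᵇ-no {3 + p} {2 + p} ≤-refl)

φrise₂-inner : ∀ p m₂ {j} → j ≤ 1 + p → φrise₂ p m₂ j ≡ m₂ j + 1
φrise₂-inner p m₂ j≤ = if-true (≤ᵇ-yes j≤)

φrise₂-last : ∀ p m₂ → φrise₂ p m₂ (2 + p) ≡ m₂ (3 + p)
φrise₂-last p m₂ = if-false (≤ᵇ-no {2 + p} {1 + p} ≤-refl)

φflat₁-inner : ∀ p m₁ m₂ {j} → j ≤ 2 + p → φflat₁ p m₁ m₂ j ≡ m₁ j
φflat₁-inner p m₁ m₂ j≤ = if-true (≤ᵇ-yes j≤)

φflat₁-last : ∀ p m₁ m₂ → φflat₁ p m₁ m₂ (3 + p) ≡ m₂ (3 + p) + 1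
φflat₁-last p m₁ m₂ = if-false (≤ᵇ-no {3 + p} {2 + p} ≤-refl)

ψin₁ : ℕ → (ℕ → ℕ) → ℕ → ℕ
ψin₁ k g₁ j = if j ≤ᵇ k then g₁ j else g₁ (suc j) + 2

ψin₂ : ℕ → (ℕ → ℕ) → (ℕ → ℕ) → ℕ → ℕ
ψin₂ k g₁ g₂ j = if j ≤ᵇ k ∸ 1 then g₂ j ∸ 1 else (if j ≡ᵇ k then g₁ (suc k) else g₂ (j ∸ 1))

ψin₁-upTo : ∀ k g₁ {j} → j ≤ k → ψin₁ k g₁ j ≡ g₁ j
ψin₁-upTo k g₁ j≤k = if-true (≤ᵇ-yes j≤k)

ψin₁-after : ∀ k g₁ {j} → k < j → ψin₁ k g₁ j ≡ g₁ (suc j) + 2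
ψin₁-after k g₁ k<j = if-false (≤ᵇ-no k<j)

ψin₂-before : ∀ k g₁ g₂ {j} → j ≤ k → ψin₂ (suc k) g₁ g₂ j ≡ g₂ j ∸ 1
ψin₂-before k g₁ g₂ j≤k = if-true (≤ᵇ-yes j≤k)

ψin₂-at : ∀ k g₁ g₂ → ψin₂ (suc k) g₁ g₂ (suc k) ≡ g₁ (2 + k)
ψin₂-at k g₁ g₂ = trans (if-false (≤ᵇ-no {suc k} {k} ≤-refl)) (if-true (≡ᵇ-yes (suc k)))

ψin₂-beyond : ∀ k g₁ g₂ {i} → suc k ≤ i → ψin₂ (suc k) g₁ g₂ (suc i) ≡ g₂ i
ψin₂-beyond k g₁ g₂ {i} k<i =
  trans (if-false (≤ᵇ-no {suc i} {k} (s≤s (≤-trans (n≤1+n _) k<i))))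
        (if-false (≡ᵇ-no (λ e → <⇒≢ (s≤s k<i) (sym e))))

ψrise₂ : ℕ → (ℕ → ℕ) → (ℕ → ℕ) → ℕ → ℕ
ψrise₂ p g₁ g₂ j = if j ≤ᵇ 1 + p then g₂ j ∸ 1 else (if j ≡ᵇ 2 + p then g₁ (3 + p) else g₂ (2 + p))

ψflat₂ : ℕ → (ℕ → ℕ) → (ℕ → ℕ) → ℕ → ℕ
ψflat₂ p g₁ g₂ j = if j ≤ᵇ 2 + p then g₂ j ∸ 1 else g₁ (3 + p) ∸ 1

ψrise₂-inner : ∀ p g₁ g₂ {j} → j ≤ 1 + p → ψrise₂ p g₁ g₂ j ≡ g₂ j ∸ 1
ψrise₂-inner p g₁ g₂ j≤ = if-true (≤ᵇ-yes j≤)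

ψrise₂-penultimate : ∀ p g₁ g₂ → ψrise₂ p g₁ g₂ (2 + p) ≡ g₁ (3 + p)
ψrise₂-penultimate p g₁ g₂ = trans (if-false (≤ᵇ-no {2 + p} {1 + p} ≤-refl)) (if-true (≡ᵇ-yes (2 + p)))

ψrise₂-last : ∀ p g₁ g₂ → ψrise₂ p g₁ g₂ (3 + p) ≡ g₂ (2 + p)
ψrise₂-last p g₁ g₂ =
  trans (if-false (≤ᵇ-no {3 + p} {1 + p} (n≤1+n _)))
        (if-false (≡ᵇ-no {3 + p} {2 + p} (λ e → <⇒≢ ≤-refl (sym e))))

ψflat₂-inner : ∀ p g₁ g₂ {j} → j ≤ 2 + p → ψflat₂ p g₁ g₂ j ≡ g₂ j ∸ 1
ψflat₂-inner p g₁ g₂ j≤ = if-true (≤ᵇ-yes j≤)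

ψflat₂-last : ∀ p g₁ g₂ → ψflat₂ p g₁ g₂ (3 + p) ≡ g₁ (3 + p) ∸ 1
ψflat₂-last p g₁ g₂ = if-false (≤ᵇ-no {3 + p} {2 + p} ≤-refl)

Φ-bug : ∀ n r₁ r₂ k → smallestBug n (r₁ , r₂) ≡ just k →
  Φ n (r₁ , r₂) ≡ (build n (φbug₁ k (r₁ !_) (r₂ !_)) , build (n ∸ 1) (φbug₂ k (r₂ !_)))
Φ-bug n r₁ r₂ k e with smallestBug n (r₁ , r₂)
Φ-bug n r₁ r₂ k refl | just .k = refl

Φ-rise : ∀ p r₁ r₂ → smallestBug (3 + p) (r₁ , r₂) ≡ nothing →
  (r₂ ! (2 + p) <ᵇ r₂ ! (3 + p)) ≡ true →
  Φ (3 + p) (r₁ , r₂) ≡ (build (3 + p) (φrise₁ p (r₁ !_) (r₂ !_)) , build (2 + p) (φrise₂ p (r₂ !_)))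
Φ-rise p r₁ r₂ e rising with smallestBug (3 + p) (r₁ , r₂)
Φ-rise p r₁ r₂ refl rising | nothing = if-true rising

Φ-flat : ∀ p r₁ r₂ → smallestBug (3 + p) (r₁ , r₂) ≡ nothing →
  (r₂ ! (2 + p) <ᵇ r₂ ! (3 + p)) ≡ false →
  Φ (3 + p) (r₁ , r₂) ≡ (build (3 + p) (φflat₁ p (r₁ !_) (r₂ !_)) , build (2 + p) (φflat₂ (r₂ !_)))
Φ-flat p r₁ r₂ e flat with smallestBug (3 + p) (r₁ , r₂)
Φ-flat p r₁ r₂ refl flat | nothing = if-false flat

Ψ-inner : ∀ n r₁ r₂ k → ψk n (r₁ , r₂) ≡ k → k ≤ n ∸ 2 →
  Ψ n (r₁ , r₂) ≡ (build (n ∸ 1) (ψin₁ k (r₁ !_)) , build n (ψin₂ k (r₁ !_) (r₂ !_)))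
Ψ-inner n r₁ r₂ k refl k≤ = if-true (≤ᵇ-yes k≤)

Ψ-rise : ∀ p r₁ r₂ → ψk (3 + p) (r₁ , r₂) ≡ 2 + p →
  (r₁ ! (3 + p) <ᵇ r₂ ! (2 + p)) ≡ true →
  Ψ (3 + p) (r₁ , r₂) ≡ (build (2 + p) (r₁ !_) , build (3 + p) (ψrise₂ p (r₁ !_) (r₂ !_)))
Ψ-rise p r₁ r₂ k≡ rising rewrite k≡ = trans (if-false (≤ᵇ-no {2 + p} {1 + p} ≤-refl)) (if-true rising)

Ψ-flat : ∀ p r₁ r₂ → ψk (3 + p) (r₁ , r₂) ≡ 2 + p →
  (r₁ ! (3 + p) <ᵇ r₂ ! (2 + p)) ≡ false →
  Ψ (3 + p) (r₁ , r₂) ≡ (build (2 + p) (r₁ !_) , build (3 + p) (ψflat₂ p (r₁ !_) (r₂ !_)))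
Ψ-flat p r₁ r₂ k≡ flat rewrite k≡ = trans (if-false (≤ᵇ-no {2 + p} {1 + p} ≤-refl)) (if-false flat)

BugFreeBelow : (ℕ → ℕ) → (ℕ → ℕ) → ℕ → Set
BugFreeBelow m₁ m₂ K = ∀ i → 1 ≤ i → i < K → m₁ (suc i) ≤ suc (m₂ i)

data ΦCase (p : ℕ) (r₁ : Vec ℕ (2 + p)) (r₂ : Vec ℕ (3 + p)) : Set where
  bugCase  : ∀ k → k ≤ p → suc (r₂ ! suc k) < r₁ ! (2 + k) → BugFreeBelow (r₁ !_) (r₂ !_) (suc k) →
    Φ (3 + p) (r₁ , r₂) ≡ (build (3 + p) (φbug₁ (suc k) (r₁ !_) (r₂ !_)) ,
                           build (2 + p) (φbug₂ (suc k) (r₂ !_))) →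
    ΦCase p r₁ r₂
  riseCase : BugFreeBelow (r₁ !_) (r₂ !_) (2 + p) → r₂ ! (2 + p) < r₂ ! (3 + p) →
    Φ (3 + p) (r₁ , r₂) ≡ (build (3 + p) (φrise₁ p (r₁ !_) (r₂ !_)) ,
                           build (2 + p) (φrise₂ p (r₂ !_))) →
    ΦCase p r₁ r₂
  flatCase : BugFreeBelow (r₁ !_) (r₂ !_) (2 + p) → r₂ ! (3 + p) ≤ r₂ ! (2 + p) →
    Φ (3 + p) (r₁ , r₂) ≡ (build (3 + p) (φflat₁ p (r₁ !_) (r₂ !_)) ,
                           build (2 + p) (φflat₂ (r₂ !_))) →
    ΦCase p r₁ r₂

bugTest : ∀ {a b} → Vec ℕ a → Vec ℕ b → ℕ → Bool
bugTest r₁ r₂ j = suc (r₂ ! j) <ᵇ r₁ ! suc j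

bugFree-of-nothing : ∀ p r₁ r₂ → smallestBug (3 + p) (r₁ , r₂) ≡ nothing →
  BugFreeBelow (r₁ !_) (r₂ !_) (2 + p)
bugFree-of-nothing p r₁ r₂ none i 1≤i i<end =
  <ᵇ-false⇒≥ (first-nothing⇒ (bugTest r₁ r₂) 1 (suc p) none i 1≤i i<end)

φCase : ∀ p r₁ r₂ → ΦCase p r₁ r₂
φCase p r₁ r₂ with smallestBug (3 + p) (r₁ , r₂) in found
... | just k with first-just⇒ (bugTest r₁ r₂) 1 (suc p) k found
...   | 1≤k , k<end , bug , noneBefore with k | 1≤k
...     | suc k′ | s≤s _ =
  bugCase k′ (≤-pred (≤-pred k<end)) (<ᵇ-true⇒< bug) (λ i 1≤i i<k → <ᵇ-false⇒≥ (noneBefore i 1≤i i<k))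
    (Φ-bug (3 + p) r₁ r₂ (suc k′) found)
φCase p r₁ r₂ | nothing with r₂ ! (2 + p) <ᵇ r₂ ! (3 + p) in rising
... | true  = riseCase (bugFree-of-nothing p r₁ r₂ found) (<ᵇ-true⇒< rising) (Φ-rise p r₁ r₂ found rising)
... | false = flatCase (bugFree-of-nothing p r₁ r₂ found) (<ᵇ-false⇒≥ rising) (Φ-flat p r₁ r₂ found rising)

ψTest : ∀ {a b} → Vec ℕ a → Vec ℕ b → ℕ → Bool
ψTest r₁ r₂ j = r₂ ! (j ∸ 1) ≤ᵇ r₁ ! suc j + 1

-- On a Gog trapezoid, ψk is the largest column 2 ≤ k ≤ n-1 passing the test;
-- the default value 2 passes it as well, since g_{2,1} ≤ 2.
ψk-spec : ∀ p r₁ r₂ → IsGog (3 + p) (r₁ , r₂) → let k = ψk (3 + p) (r₁ , r₂) in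
  2 ≤ k × k ≤ 2 + p × r₂ ! (k ∸ 1) ≤ r₁ ! suc k + 1 ×
  (∀ i → k < i → i ≤ 2 + p → r₁ ! suc i + 1 < r₂ ! (i ∸ 1))
ψk-spec p r₁ r₂ ig with lastDown-spec (ψTest r₁ r₂) (2 + p) 2 (s≤s (s≤s z≤n))
... | 2≤k , k≤ , witness , above = 2≤k , k≤ , passes witness , λ i k<i i≤ → ≤ᵇ-false⇒> (above i k<i i≤)
  where
  open IsGog ig
  k = ψk (3 + p) (r₁ , r₂)
  passes : k ≡ 2 ⊎ ψTest r₁ r₂ k ≡ true → r₂ ! (k ∸ 1) ≤ r₁ ! suc k + 1
  passes (inj₂ test) = ≤ᵇ-true⇒≤ test
  passes (inj₁ k≡2) rewrite k≡2 =
    ≤-trans (≤-pred (subst (r₂ ! 1 <_) (+-comm 1 2) (bnd 1 (s≤s z≤n) (s≤s z≤n))))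
            (subst (2 ≤_) (sym (+-comm (r₁ ! 3) 1)) (s≤s (pos₁ 3 (s≤s z≤n) (s≤s (s≤s (s≤s z≤n))))))

ψk-at-last : ∀ p r₁ r₂ → ψTest r₁ r₂ (2 + p) ≡ true → ψk (3 + p) (r₁ , r₂) ≡ 2 + p
ψk-at-last p r₁ r₂ passes =
  lastDown-finds (ψTest r₁ r₂) (2 + p) 2 (2 + p) (s≤s (s≤s z≤n)) ≤-refl passes
                 (λ i last<i i≤last → ⊥-elim (<⇒≱ last<i i≤last))

data ΨCase (p : ℕ) (r₁ : Vec ℕ (3 + p)) (r₂ : Vec ℕ (2 + p)) : Set where
  innerCase : ∀ q → suc q ≤ p → r₂ ! suc q ≤ r₁ ! (3 + q) + 1 →
    (∀ i → 2 + q < i → i ≤ 2 + p → r₁ ! suc i + 1 < r₂ ! (i ∸ 1)) →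
    Ψ (3 + p) (r₁ , r₂) ≡ (build (2 + p) (ψin₁ (2 + q) (r₁ !_)) ,
                           build (3 + p) (ψin₂ (2 + q) (r₁ !_) (r₂ !_))) →
    ΨCase p r₁ r₂
  riseCase : r₁ ! (3 + p) < r₂ ! (2 + p) → r₂ ! (1 + p) ≤ r₁ ! (3 + p) + 1 →
    Ψ (3 + p) (r₁ , r₂) ≡ (build (2 + p) (r₁ !_) , build (3 + p) (ψrise₂ p (r₁ !_) (r₂ !_))) →
    ΨCase p r₁ r₂
  flatCase : r₂ ! (2 + p) ≤ r₁ ! (3 + p) →
    Ψ (3 + p) (r₁ , r₂) ≡ (build (2 + p) (r₁ !_) , build (3 + p) (ψflat₂ p (r₁ !_) (r₂ !_))) →
    ΨCase p r₁ r₂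

ψCase : ∀ p r₁ r₂ → IsGog (3 + p) (r₁ , r₂) → ΨCase p r₁ r₂
ψCase p r₁ r₂ ig with ψk (3 + p) (r₁ , r₂) in k≡ | ψk-spec p r₁ r₂ ig
... | suc (suc q) | s≤s (s≤s _) , k≤ , passes , above with ≤-<-connex (suc q) p
...   | inj₁ q<p = innerCase q q<p passes above (Ψ-inner (3 + p) r₁ r₂ (2 + q) k≡ (s≤s q<p))
...   | inj₂ p<1+q with ≤-antisym (≤-pred (≤-pred k≤)) (≤-pred p<1+q)
...     | refl with r₁ ! (3 + q) <ᵇ r₂ ! (2 + q) in rising
...       | true  = riseCase (<ᵇ-true⇒< rising) passes (Ψ-rise q r₁ r₂ k≡ rising)
...       | false = flatCase (<ᵇ-false⇒≥ rising) (Ψ-flat q r₁ r₂ k≡ rising)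

+1≡suc : ∀ m → m + 1 ≡ suc m
+1≡suc m = +-comm m 1

1≤+1 : ∀ m → 1 ≤ m + 1
1≤+1 m = m≤n+m 1 m

≤⇒<+1 : ∀ {a b} → a ≤ b → a < b + 1
≤⇒<+1 {a} {b} a≤b = subst (a <_) (sym (+1≡suc b)) (s≤s a≤b)

<⇒+1≤ : ∀ {a b} → a < b → a + 1 ≤ b
<⇒+1≤ {a} {b} a<b = subst (_≤ b) (sym (+1≡suc a)) a<b

≤suc⇒<+2 : ∀ {a j} → a ≤ suc j → a < j + 2
≤suc⇒<+2 {a} {j} a≤ = subst (a <_) (sym (+-comm j 2)) (s≤s a≤)

<+2⇒≤suc : ∀ {a j} → a < j + 2 → a ≤ suc j
<+2⇒≤suc {a} {j} a< = ≤-pred (subst (a <_) (+-comm j 2) a<)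

≤⇒+1<+2 : ∀ {a j} → a ≤ j → a + 1 < j + 2
≤⇒+1<+2 {a} {j} a≤j = ≤suc⇒<+2 (subst (_≤ suc j) (sym (+1≡suc a)) (s≤s a≤j))

≤⇒suc<+2 : ∀ {a b} → a ≤ b → suc a < b + 2
≤⇒suc<+2 a≤b = ≤suc⇒<+2 (s≤s a≤b)

<+2⇒∸1≤ : ∀ {a j} → a < j + 2 → a ∸ 1 ≤ j
<+2⇒∸1≤ {zero}  _  = z≤n
<+2⇒∸1≤ {suc a} a< = ≤-pred (<+2⇒≤suc a<)

≤+1⇒∸1≤ : ∀ {a b} → a ≤ b + 1 → a ∸ 1 ≤ b
≤+1⇒∸1≤ {zero}  _  = z≤n
≤+1⇒∸1≤ {suc a} {b} a≤ = ≤-pred (subst (suc a ≤_) (+1≡suc b) a≤)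

<⇒≤∸1 : ∀ {a b} → a < b → a ≤ b ∸ 1
<⇒≤∸1 (s≤s a≤b) = a≤b

+1<⇒+2≤ : ∀ {a b} → a + 1 < b → a + 2 ≤ b
+1<⇒+2≤ {a} {b} a+1<b = subst (_≤ b) (trans (cong suc (+1≡suc a)) (sym (+-comm a 2))) a+1<b

2+≤⇒≤∸2 : ∀ {a b} → 2 + a ≤ b → a ≤ b ∸ 2
2+≤⇒≤∸2 (s≤s (s≤s a≤b)) = a≤b

2≤⇒1≤∸1 : ∀ {x} → 2 ≤ x → 1 ≤ x ∸ 1
2≤⇒1≤∸1 (s≤s (s≤s _)) = s≤s z≤n

3≤⇒1≤∸2 : ∀ {x} → 3 ≤ x → 1 ≤ x ∸ 2
3≤⇒1≤∸2 (s≤s (s≤s (s≤s _))) = s≤s z≤n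

1≤⇒∸2< : ∀ {x} → 1 ≤ x → x ∸ 2 < x
1≤⇒∸2< {suc x} _ = s≤s (m∸n≤m x 1)

3≤⇒∸2+1< : ∀ {x} → 3 ≤ x → x ∸ 2 + 1 < x
3≤⇒∸2+1< {suc (suc (suc x))} (s≤s (s≤s (s≤s _))) = subst (_< 3 + x) (sym (+1≡suc (suc x))) ≤-refl

module OnMagog (p : ℕ) (r₁ : Vec ℕ (2 + p)) (r₂ : Vec ℕ (3 + p))
               (im : IsMagog (3 + p) (r₁ , r₂)) where
  open IsMagog im

  m₁ m₂ : ℕ → ℕ
  m₁ = r₁ !_
  m₂ = r₂ !_

  m₂≤col : ∀ j → 1 ≤ j → j ≤ 3 + p → m₂ j ≤ j
  m₂≤col j 1≤j j≤ with upTo (2 + p) j j≤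
  ... | inner j≤′ = bnd j 1≤j j≤′
  ... | last      = bndₙ

  m₁-mono : ∀ i j → 1 ≤ i → i ≤ j → j ≤ 2 + p → m₁ i ≤ m₁ j
  m₁-mono = stepwise-mono m₁ 1 (2 + p) (λ j 1≤j j< → mono₁ j 1≤j (≤-pred j<))

  m₂-mono : ∀ i j → 1 ≤ i → i ≤ j → j ≤ 3 + p → m₂ i ≤ m₂ j
  m₂-mono = stepwise-mono m₂ 1 (3 + p) (λ j 1≤j j< → mono₂ j 1≤j (≤-pred j<))

  -- Beyond a bug the first row is at least 3, so lowering it by 2 keeps it
  -- positive (and reversible).
  ≥3-beyond-bug : ∀ K → 1 ≤ K → K ≤ 1 + p → suc (m₂ K) < m₁ (suc K) →
    ∀ i → suc K ≤ i → i ≤ 2 + p → 3 ≤ m₁ i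
  ≥3-beyond-bug K 1≤K K≤ bug i K<i i≤ =
    ≤-trans (≤-trans (s≤s (s≤s (pos₂ K 1≤K (≤-trans K≤ (≤-trans (n≤1+n _) (n≤1+n _)))))) bug)
            (m₁-mono (suc K) i (s≤s z≤n) K<i i≤)

  -- Column 1 is never a bug, since m_{1,2} ≤ m_{2,2} ≤ 2.
  no-bug-at-1 : ¬ (suc (m₂ 1) < m₁ 2)
  no-bug-at-1 bug = <⇒≱ (≤-trans (s≤s (s≤s (pos₂ 1 (s≤s z≤n) (s≤s z≤n))))
                                  (≤-trans bug (col 2 (s≤s z≤n) (s≤s (s≤s z≤n)))))
                        (bnd 2 (s≤s z≤n) (s≤s (s≤s z≤n)))

  bug-column-≥2 : ∀ k → suc (m₂ (suc k)) < m₁ (2 + k) → 1 ≤ k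
  bug-column-≥2 zero    bug = ⊥-elim (no-bug-at-1 bug)
  bug-column-≥2 (suc k) _   = s≤s z≤n

  module BugCase (k : ℕ) (k≤p : k ≤ p) (bug : suc (m₂ (suc k)) < m₁ (2 + k))
                 (bugFree : BugFreeBelow m₁ m₂ (suc k)) where
    K : ℕ
    K = suc k

    f₁ f₂ : ℕ → ℕ
    f₁ = φbug₁ K m₁ m₂
    f₂ = φbug₂ K m₂

    K≤1+p : K ≤ 1 + p
    K≤1+p = s≤s k≤p

    K≤2+p : K ≤ 2 + p
    K≤2+p = m≤n⇒m≤1+n K≤1+p

    m₁≥3 : ∀ i → suc K ≤ i → i ≤ 2 + p → 3 ≤ m₁ i
    m₁≥3 = ≥3-beyond-bug K (s≤s z≤n) K≤1+p bug

    m₂K<m₁K+1 : m₂ K < m₁ (suc K)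
    m₂K<m₁K+1 = ≤-trans (n≤1+n _) bug

    m₁K+1≤m₂K+1 : m₁ (suc K) ≤ m₂ (suc K)
    m₁K+1≤m₂K+1 = col (suc K) (s≤s z≤n) (s≤s K≤1+p)

    pos₁′ : ∀ j → 1 ≤ j → j ≤ 3 + p → 1 ≤ f₁ j
    pos₁′ j 1≤j j≤ with around K j
    ... | before j≤K = ≤-via refl (φbug₁-before K m₁ m₂ j≤K) (pos₁ j 1≤j (≤-trans j≤K K≤2+p))
    ... | next       = ≤-via refl (φbug₁-next K m₁ m₂) (pos₂ K (s≤s z≤n) (m≤n⇒m≤1+n K≤2+p))
    pos₁′ (suc i) 1≤j j≤ | beyond K<i =
      ≤-via refl (φbug₁-beyond K m₁ m₂ K<i) (3≤⇒1≤∸2 (m₁≥3 i K<i (≤-pred j≤)))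

    pos₂′ : ∀ j → 1 ≤ j → j ≤ 2 + p → 1 ≤ f₂ j
    pos₂′ j 1≤j j≤ with ≤-<-connex j k
    ... | inj₁ j≤k = ≤-via refl (φbug₂-before k m₂ j≤k) (1≤+1 (m₂ j))
    ... | inj₂ k<j = ≤-via refl (φbug₂-from k m₂ k<j) (pos₂ (suc j) (s≤s z≤n) (s≤s j≤))

    mono₁′ : ∀ j → 1 ≤ j → j ≤ 2 + p → f₁ j ≤ f₁ (suc j)
    mono₁′ j 1≤j j≤ with around K j
    ... | before j≤K with m≤n⇒m<n∨m≡n j≤K
    ...   | inj₁ j<K  = ≤-via (φbug₁-before K m₁ m₂ j≤K) (φbug₁-before K m₁ m₂ j<K)
                              (mono₁ j 1≤j (m≤n⇒m≤1+n (≤-trans (≤-pred j<K) k≤p)))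
    ...   | inj₂ refl = ≤-via (φbug₁-before K m₁ m₂ j≤K) (φbug₁-next K m₁ m₂) (col K 1≤j K≤2+p)
    mono₁′ j 1≤j j≤ | next = ≤-via (φbug₁-next K m₁ m₂) (φbug₁-beyond K m₁ m₂ ≤-refl) (2+≤⇒≤∸2 bug)
    mono₁′ (suc i) 1≤j j≤ | beyond K<i =
      ≤-via (φbug₁-beyond K m₁ m₂ K<i) (φbug₁-beyond K m₁ m₂ (m≤n⇒m≤1+n K<i))
            (∸-monoˡ-≤ 2 (mono₁ i (≤-trans (s≤s z≤n) K<i) (≤-pred j≤)))

    mono₂′ : ∀ j → 1 ≤ j → j ≤ 1 + p → f₂ j ≤ f₂ (suc j)
    mono₂′ j 1≤j j≤ with ≤-<-connex j k
    ... | inj₂ k<j = ≤-via (φbug₂-from k m₂ k<j) (φbug₂-from k m₂ (m≤n⇒m≤1+n k<j))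
                           (mono₂ (suc j) (s≤s z≤n) (s≤s j≤))
    ... | inj₁ j≤k with m≤n⇒m<n∨m≡n j≤k
    ...   | inj₁ j<k  = ≤-via (φbug₂-before k m₂ j≤k) (φbug₂-before k m₂ j<k)
                              (+-monoˡ-≤ 1 (mono₂ j 1≤j (m≤n⇒m≤1+n j≤)))
    ...   | inj₂ refl = ≤-via (φbug₂-before k m₂ j≤k) (φbug₂-from k m₂ ≤-refl)
          (≤-trans (+-monoˡ-≤ 1 (mono₂ j 1≤j (m≤n⇒m≤1+n j≤)))
                   (≤-trans (≤-via (+1≡suc (m₂ K)) refl (<⇒≤ bug)) m₁K+1≤m₂K+1))

    col′ : ∀ j → 1 ≤ j → j ≤ 2 + p → f₁ j < f₂ j
    col′ j 1≤j j≤ with around K j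
    ... | before j≤K with m≤n⇒m<n∨m≡n j≤K
    ...   | inj₁ j<K  = <-via (φbug₁-before K m₁ m₂ j≤K) (φbug₂-before k m₂ (≤-pred j<K))
                              (≤⇒<+1 (col j 1≤j j≤))
    ...   | inj₂ refl = <-via (φbug₁-before K m₁ m₂ j≤K) (φbug₂-from k m₂ ≤-refl)
                              (≤-<-trans (col K 1≤j K≤2+p) (<-≤-trans m₂K<m₁K+1 m₁K+1≤m₂K+1))
    col′ j 1≤j j≤ | next = <-via (φbug₁-next K m₁ m₂) (φbug₂-from k m₂ (n≤1+n _))
      (<-≤-trans m₂K<m₁K+1 (≤-trans m₁K+1≤m₂K+1 (mono₂ (suc K) (s≤s z≤n) j≤)))
    col′ (suc i) 1≤j j≤ | beyond K<i =
      <-via (φbug₁-beyond K m₁ m₂ K<i) (φbug₂-from k m₂ (≤-trans (n≤1+n _) (m≤n⇒m≤1+n K<i)))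
        (<-≤-trans (1≤⇒∸2< (≤-trans (s≤s z≤n) (m₁≥3 i K<i i≤2+p)))
                   (≤-trans (col i 1≤i i≤2+p)
                            (m₂-mono i (2 + i) 1≤i (≤-trans (n≤1+n _) (n≤1+n _)) (s≤s j≤))))
      where
      1≤i : 1 ≤ i
      1≤i = ≤-trans (s≤s z≤n) K<i
      i≤2+p : i ≤ 2 + p
      i≤2+p = m≤n⇒m≤1+n (≤-pred j≤)

    bnd′ : ∀ j → 1 ≤ j → j ≤ 2 + p → f₂ j < j + 2
    bnd′ j 1≤j j≤ with ≤-<-connex j k
    ... | inj₁ j≤k = <-via (φbug₂-before k m₂ j≤k) refl (≤⇒+1<+2 (bnd j 1≤j j≤))
    ... | inj₂ k<j = <-via (φbug₂-from k m₂ k<j) refl (≤suc⇒<+2 (m₂≤col (suc j) (s≤s z≤n) (s≤s j≤)))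

    diag′ : ∀ j → 1 ≤ j → j ≤ 2 + p → f₁ (suc j) ≤ f₂ j
    diag′ j 1≤j j≤ with around K (suc j)
    ... | before j<K = ≤-via (φbug₁-before K m₁ m₂ j<K) (trans (φbug₂-before k m₂ (≤-pred j<K)) (+1≡suc (m₂ j)))
                             (bugFree j 1≤j j<K)
    diag′ .K 1≤j j≤ | next = ≤-via (φbug₁-next K m₁ m₂) (φbug₂-from k m₂ ≤-refl) (mono₂ K 1≤j j≤)
    ... | beyond K<j = ≤-via (φbug₁-beyond K m₁ m₂ K<j) (φbug₂-from k m₂ (≤-trans (n≤1+n _) K<j))
                             (≤-trans (m∸n≤m (m₁ j) 2) (≤-trans (col j 1≤j j≤) (mono₂ j 1≤j j≤)))

    isGog-Φ : IsGog (3 + p) (build (3 + p) f₁ , build (2 + p) f₂)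
    isGog-Φ = isGog-build p f₁ f₂ pos₁′ pos₂′ mono₁′ mono₂′ col′ bnd′ diag′

    -- Ψ recovers M from Φ(M) = (V₁, V₂): its search stops exactly at K.
    V₁ : Vec ℕ (3 + p)
    V₁ = build (3 + p) f₁
    V₂ : Vec ℕ (2 + p)
    V₂ = build (2 + p) f₂

    1≤k : 1 ≤ k
    1≤k = bug-column-≥2 k bug

    -- At K the test g_{2,K-1} ≤ g_{1,K+1} + 1 reads m_{2,k} + 1 ≤ m_{2,K} + 1.
    passes-at-K : ψTest V₁ V₂ K ≡ true
    passes-at-K = ≤ᵇ-yes (≤-via (trans (!-build (2 + p) f₂ k 1≤k k≤2+p) (φbug₂-before k m₂ ≤-refl))
                               (cong (_+ 1) (trans (!-build (3 + p) f₁ (suc K) (s≤s z≤n) (s≤s K≤2+p))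
                                                   (φbug₁-next K m₁ m₂)))
                               (+-monoˡ-≤ 1 (mono₂ k 1≤k k≤2+p)))
      where
      k≤2+p : k ≤ 2 + p
      k≤2+p = ≤-trans (n≤1+n k) K≤2+p

    -- Beyond K it reads m_{1,i+1} - 2 + 1 < m_{2,i+1}, which fails as m_{1,i+1} ≥ 3.
    fails-beyond-K : ∀ i → K < i → i ≤ 2 + p → ψTest V₁ V₂ i ≡ false
    fails-beyond-K (suc i) (s≤s K≤i) i< = ≤ᵇ-no (<-via
      (cong (_+ 1) (trans (!-build (3 + p) f₁ (2 + i) (s≤s z≤n) (s≤s i<))
                          (φbug₁-beyond K m₁ m₂ (s≤s K≤i))))
      (trans (!-build (2 + p) f₂ i (≤-trans (s≤s z≤n) K≤i) (≤-trans (n≤1+n i) i<)) (φbug₂-from k m₂ K≤i))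
      (<-≤-trans (3≤⇒∸2+1< (m₁≥3 (suc i) (s≤s K≤i) i<)) (col (suc i) (s≤s z≤n) i<)))

    ψk≡K : ψk (3 + p) (V₁ , V₂) ≡ K
    ψk≡K = lastDown-finds (ψTest V₁ V₂) (2 + p) 2 K (s≤s 1≤k) K≤2+p passes-at-K fails-beyond-K

    row₁-recovered : ∀ j → 1 ≤ j → j ≤ 2 + p → ψin₁ K (V₁ !_) j ≡ r₁ ! j
    row₁-recovered j 1≤j j≤ with ≤-<-connex j K
    ... | inj₁ j≤K = begin
      ψin₁ K (V₁ !_) j  ≡⟨ ψin₁-upTo K (V₁ !_) j≤K ⟩
      V₁ ! j            ≡⟨ !-build (3 + p) f₁ j 1≤j (m≤n⇒m≤1+n j≤) ⟩
      f₁ j              ≡⟨ φbug₁-before K m₁ m₂ j≤K ⟩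
      m₁ j              ∎
      where open ≡-Reasoning
    ... | inj₂ K<j = begin
      ψin₁ K (V₁ !_) j  ≡⟨ ψin₁-after K (V₁ !_) K<j ⟩
      V₁ ! suc j + 2    ≡⟨ cong (_+ 2) (!-build (3 + p) f₁ (suc j) (s≤s z≤n) (s≤s j≤)) ⟩
      f₁ (suc j) + 2    ≡⟨ cong (_+ 2) (φbug₁-beyond K m₁ m₂ K<j) ⟩
      m₁ j ∸ 2 + 2      ≡⟨ m∸n+n≡m (≤-trans (n≤1+n 2) (m₁≥3 j K<j j≤)) ⟩
      m₁ j              ∎
      where open ≡-Reasoning

    row₂-recovered : ∀ j → 1 ≤ j → j ≤ 3 + p → ψin₂ K (V₁ !_) (V₂ !_) j ≡ r₂ ! j
    row₂-recovered j 1≤j j≤ with around k j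
    ... | before j≤k = begin
      ψin₂ K (V₁ !_) (V₂ !_) j  ≡⟨ ψin₂-before k (V₁ !_) (V₂ !_) j≤k ⟩
      V₂ ! j ∸ 1                ≡⟨ cong (_∸ 1) (!-build (2 + p) f₂ j 1≤j (≤-trans j≤k (≤-trans (n≤1+n k) K≤2+p))) ⟩
      f₂ j ∸ 1                  ≡⟨ cong (_∸ 1) (φbug₂-before k m₂ j≤k) ⟩
      m₂ j + 1 ∸ 1              ≡⟨ m+n∸n≡m (m₂ j) 1 ⟩
      m₂ j                      ∎
      where open ≡-Reasoning
    ... | next = begin
      ψin₂ K (V₁ !_) (V₂ !_) K  ≡⟨ ψin₂-at k (V₁ !_) (V₂ !_) ⟩
      V₁ ! suc K                ≡⟨ !-build (3 + p) f₁ (suc K) (s≤s z≤n) (s≤s K≤2+p) ⟩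
      f₁ (suc K)                ≡⟨ φbug₁-next K m₁ m₂ ⟩
      m₂ K                      ∎
      where open ≡-Reasoning
    row₂-recovered (suc i) 1≤j j≤ | beyond K≤i = begin
      ψin₂ K (V₁ !_) (V₂ !_) (suc i)  ≡⟨ ψin₂-beyond k (V₁ !_) (V₂ !_) K≤i ⟩
      V₂ ! i                          ≡⟨ !-build (2 + p) f₂ i (≤-trans (s≤s z≤n) K≤i) (≤-pred j≤) ⟩
      f₂ i                            ≡⟨ φbug₂-from k m₂ K≤i ⟩
      m₂ (suc i)                      ∎
      where open ≡-Reasoning

    Ψ-recovers : Ψ (3 + p) (V₁ , V₂) ≡ (r₁ , r₂)
    Ψ-recovers = trans (Ψ-inner (3 + p) V₁ V₂ K ψk≡K K≤1+p)
      (cong₂ _,_ (build-ext (2 + p) (ψin₁ K (V₁ !_)) r₁ row₁-recovered)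
                 (build-ext (3 + p) (ψin₂ K (V₁ !_) (V₂ !_)) r₂ row₂-recovered))

  module NoBug (bugFree : BugFreeBelow m₁ m₂ (2 + p)) where

    bugFree′ : ∀ j → 1 ≤ j → j ≤ 1 + p → m₁ (suc j) ≤ m₂ j + 1
    bugFree′ j 1≤j j≤ = ≤-via refl (+1≡suc (m₂ j)) (bugFree j 1≤j (s≤s j≤))

    module Rise (rising : m₂ (2 + p) < m₂ (3 + p)) where
      g₁ g₂ : ℕ → ℕ
      g₁ = φrise₁ p m₁ m₂
      g₂ = φrise₂ p m₂

      pos₁′ : ∀ j → 1 ≤ j → j ≤ 3 + p → 1 ≤ g₁ j
      pos₁′ j 1≤j j≤ with upTo (2 + p) j j≤
      ... | inner j≤′ = ≤-via refl (φrise₁-inner p m₁ m₂ j≤′) (pos₁ j 1≤j j≤′)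
      ... | last      = ≤-via refl (φrise₁-last p m₁ m₂) (pos₂ (2 + p) (s≤s z≤n) (n≤1+n _))

      pos₂′ : ∀ j → 1 ≤ j → j ≤ 2 + p → 1 ≤ g₂ j
      pos₂′ j 1≤j j≤ with upTo (1 + p) j j≤
      ... | inner j≤′ = ≤-via refl (φrise₂-inner p m₂ j≤′) (1≤+1 (m₂ j))
      ... | last      = ≤-via refl (φrise₂-last p m₂) (pos₂ (3 + p) (s≤s z≤n) ≤-refl)

      mono₁′ : ∀ j → 1 ≤ j → j ≤ 2 + p → g₁ j ≤ g₁ (suc j)
      mono₁′ j 1≤j j≤ with upTo (1 + p) j j≤
      ... | inner j≤′ = ≤-via (φrise₁-inner p m₁ m₂ j≤) (φrise₁-inner p m₁ m₂ (s≤s j≤′)) (mono₁ j 1≤j j≤′)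
      ... | last      = ≤-via (φrise₁-inner p m₁ m₂ j≤) (φrise₁-last p m₁ m₂) (col (2 + p) 1≤j ≤-refl)

      mono₂′ : ∀ j → 1 ≤ j → j ≤ 1 + p → g₂ j ≤ g₂ (suc j)
      mono₂′ j 1≤j j≤ with upTo p j j≤
      ... | inner j≤′ = ≤-via (φrise₂-inner p m₂ j≤) (φrise₂-inner p m₂ (s≤s j≤′))
                              (+-monoˡ-≤ 1 (mono₂ j 1≤j (m≤n⇒m≤1+n j≤)))
      ... | last      = ≤-via (φrise₂-inner p m₂ j≤) (φrise₂-last p m₂)
                              (<⇒+1≤ (≤-<-trans (mono₂ (1 + p) 1≤j (n≤1+n _)) rising))

      col′ : ∀ j → 1 ≤ j → j ≤ 2 + p → g₁ j < g₂ j
      col′ j 1≤j j≤ with upTo (1 + p) j j≤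
      ... | inner j≤′ = <-via (φrise₁-inner p m₁ m₂ j≤) (φrise₂-inner p m₂ j≤′) (≤⇒<+1 (col j 1≤j j≤))
      ... | last      = <-via (φrise₁-inner p m₁ m₂ j≤) (φrise₂-last p m₂) (≤-<-trans (col (2 + p) 1≤j ≤-refl) rising)

      bnd′ : ∀ j → 1 ≤ j → j ≤ 2 + p → g₂ j < j + 2
      bnd′ j 1≤j j≤ with upTo (1 + p) j j≤
      ... | inner j≤′ = <-via (φrise₂-inner p m₂ j≤′) refl (≤⇒+1<+2 (bnd j 1≤j j≤))
      ... | last      = <-via (φrise₂-last p m₂) refl (≤suc⇒<+2 bndₙ)

      diag′ : ∀ j → 1 ≤ j → j ≤ 2 + p → g₁ (suc j) ≤ g₂ j
      diag′ j 1≤j j≤ with upTo (1 + p) j j≤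
      ... | inner j≤′ = ≤-via (φrise₁-inner p m₁ m₂ (s≤s j≤′)) (φrise₂-inner p m₂ j≤′) (bugFree′ j 1≤j j≤′)
      ... | last      = ≤-via (φrise₁-last p m₁ m₂) (φrise₂-last p m₂) (<⇒≤ rising)

      isGog-Φ : IsGog (3 + p) (build (3 + p) g₁ , build (2 + p) g₂)
      isGog-Φ = isGog-build p g₁ g₂ pos₁′ pos₂′ mono₁′ mono₂′ col′ bnd′ diag′

      V₁ : Vec ℕ (3 + p)
      V₁ = build (3 + p) g₁
      V₂ : Vec ℕ (2 + p)
      V₂ = build (2 + p) g₂

      V₁-last : V₁ ! (3 + p) ≡ m₂ (2 + p)
      V₁-last = trans (!-build (3 + p) g₁ (3 + p) (s≤s z≤n) ≤-refl) (φrise₁-last p m₁ m₂)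

      V₂-last : V₂ ! (2 + p) ≡ m₂ (3 + p)
      V₂-last = trans (!-build (2 + p) g₂ (2 + p) (s≤s z≤n) ≤-refl) (φrise₂-last p m₂)

      ψk≡last : ψk (3 + p) (V₁ , V₂) ≡ 2 + p
      ψk≡last = ψk-at-last p V₁ V₂ (≤ᵇ-yes (≤-via
        (trans (!-build (2 + p) g₂ (1 + p) (s≤s z≤n) (n≤1+n _)) (φrise₂-inner p m₂ ≤-refl))
        (cong (_+ 1) V₁-last)
        (+-monoˡ-≤ 1 (mono₂ (1 + p) (s≤s z≤n) (n≤1+n _)))))

      row₁-recovered : ∀ j → 1 ≤ j → j ≤ 2 + p → V₁ ! j ≡ r₁ ! j
      row₁-recovered j 1≤j j≤ = trans (!-build (3 + p) g₁ j 1≤j (m≤n⇒m≤1+n j≤)) (φrise₁-inner p m₁ m₂ j≤)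

      row₂-recovered : ∀ j → 1 ≤ j → j ≤ 3 + p → ψrise₂ p (V₁ !_) (V₂ !_) j ≡ r₂ ! j
      row₂-recovered j 1≤j j≤ with upTo (2 + p) j j≤
      ... | last = trans (ψrise₂-last p (V₁ !_) (V₂ !_)) V₂-last
      ... | inner j≤′ with upTo (1 + p) j j≤′
      ...   | last = trans (ψrise₂-penultimate p (V₁ !_) (V₂ !_)) V₁-last
      ...   | inner j≤″ = begin
        ψrise₂ p (V₁ !_) (V₂ !_) j  ≡⟨ ψrise₂-inner p (V₁ !_) (V₂ !_) j≤″ ⟩
        V₂ ! j ∸ 1                  ≡⟨ cong (_∸ 1) (!-build (2 + p) g₂ j 1≤j j≤′) ⟩
        g₂ j ∸ 1                    ≡⟨ cong (_∸ 1) (φrise₂-inner p m₂ j≤″) ⟩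
        m₂ j + 1 ∸ 1                ≡⟨ m+n∸n≡m (m₂ j) 1 ⟩
        m₂ j                        ∎
        where open ≡-Reasoning

      Ψ-recovers : Ψ (3 + p) (V₁ , V₂) ≡ (r₁ , r₂)
      Ψ-recovers = trans (Ψ-rise p V₁ V₂ ψk≡last (<ᵇ-yes (<-via V₁-last V₂-last rising)))
        (cong₂ _,_ (build-ext (2 + p) (V₁ !_) r₁ row₁-recovered)
                   (build-ext (3 + p) (ψrise₂ p (V₁ !_) (V₂ !_)) r₂ row₂-recovered))

    module Flat (flat : m₂ (3 + p) ≤ m₂ (2 + p)) where
      g₁ g₂ : ℕ → ℕ
      g₁ = φflat₁ p m₁ m₂
      g₂ = φflat₂ m₂

      pos₁′ : ∀ j → 1 ≤ j → j ≤ 3 + p → 1 ≤ g₁ j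
      pos₁′ j 1≤j j≤ with upTo (2 + p) j j≤
      ... | inner j≤′ = ≤-via refl (φflat₁-inner p m₁ m₂ j≤′) (pos₁ j 1≤j j≤′)
      ... | last      = ≤-via refl (φflat₁-last p m₁ m₂) (1≤+1 (m₂ (3 + p)))

      pos₂′ : ∀ j → 1 ≤ j → j ≤ 2 + p → 1 ≤ g₂ j
      pos₂′ j _ _ = 1≤+1 (m₂ j)

      mono₁′ : ∀ j → 1 ≤ j → j ≤ 2 + p → g₁ j ≤ g₁ (suc j)
      mono₁′ j 1≤j j≤ with upTo (1 + p) j j≤
      ... | inner j≤′ = ≤-via (φflat₁-inner p m₁ m₂ j≤) (φflat₁-inner p m₁ m₂ (s≤s j≤′)) (mono₁ j 1≤j j≤′)
      ... | last      = ≤-via (φflat₁-inner p m₁ m₂ j≤) (φflat₁-last p m₁ m₂)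
          (≤-trans (col (2 + p) 1≤j ≤-refl) (≤-trans (mono₂ (2 + p) 1≤j ≤-refl) (m≤m+n _ 1)))

      mono₂′ : ∀ j → 1 ≤ j → j ≤ 1 + p → g₂ j ≤ g₂ (suc j)
      mono₂′ j 1≤j j≤ = +-monoˡ-≤ 1 (mono₂ j 1≤j (m≤n⇒m≤1+n j≤))

      col′ : ∀ j → 1 ≤ j → j ≤ 2 + p → g₁ j < g₂ j
      col′ j 1≤j j≤ = <-via (φflat₁-inner p m₁ m₂ j≤) refl (≤⇒<+1 (col j 1≤j j≤))

      bnd′ : ∀ j → 1 ≤ j → j ≤ 2 + p → g₂ j < j + 2
      bnd′ j 1≤j j≤ = ≤⇒+1<+2 (bnd j 1≤j j≤)

      diag′ : ∀ j → 1 ≤ j → j ≤ 2 + p → g₁ (suc j) ≤ g₂ j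
      diag′ j 1≤j j≤ with upTo (1 + p) j j≤
      ... | inner j≤′ = ≤-via (φflat₁-inner p m₁ m₂ (s≤s j≤′)) refl (bugFree′ j 1≤j j≤′)
      ... | last      = ≤-via (φflat₁-last p m₁ m₂) refl (+-monoˡ-≤ 1 flat)

      isGog-Φ : IsGog (3 + p) (build (3 + p) g₁ , build (2 + p) g₂)
      isGog-Φ = isGog-build p g₁ g₂ pos₁′ pos₂′ mono₁′ mono₂′ col′ bnd′ diag′

      V₁ : Vec ℕ (3 + p)
      V₁ = build (3 + p) g₁
      V₂ : Vec ℕ (2 + p)
      V₂ = build (2 + p) g₂

      V₁-last : V₁ ! (3 + p) ≡ m₂ (3 + p) + 1
      V₁-last = trans (!-build (3 + p) g₁ (3 + p) (s≤s z≤n) ≤-refl) (φflat₁-last p m₁ m₂)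

      V₂-entry : ∀ j → 1 ≤ j → j ≤ 2 + p → V₂ ! j ≡ m₂ j + 1
      V₂-entry = !-build (2 + p) g₂

      ψk≡last : ψk (3 + p) (V₁ , V₂) ≡ 2 + p
      ψk≡last = ψk-at-last p V₁ V₂ (≤ᵇ-yes (≤-via (V₂-entry (1 + p) (s≤s z≤n) (n≤1+n _)) (cong (_+ 1) V₁-last)
        (+-monoˡ-≤ 1 (≤-trans (m₂-mono (1 + p) (3 + p) (s≤s z≤n) (≤-trans (n≤1+n _) (n≤1+n _)) ≤-refl)
                              (m≤m+n _ 1)))))

      row₁-recovered : ∀ j → 1 ≤ j → j ≤ 2 + p → V₁ ! j ≡ r₁ ! j
      row₁-recovered j 1≤j j≤ = trans (!-build (3 + p) g₁ j 1≤j (m≤n⇒m≤1+n j≤)) (φflat₁-inner p m₁ m₂ j≤)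

      row₂-recovered : ∀ j → 1 ≤ j → j ≤ 3 + p → ψflat₂ p (V₁ !_) (V₂ !_) j ≡ r₂ ! j
      row₂-recovered j 1≤j j≤ with upTo (2 + p) j j≤
      ... | last = begin
        ψflat₂ p (V₁ !_) (V₂ !_) (3 + p)  ≡⟨ ψflat₂-last p (V₁ !_) (V₂ !_) ⟩
        V₁ ! (3 + p) ∸ 1                  ≡⟨ cong (_∸ 1) V₁-last ⟩
        m₂ (3 + p) + 1 ∸ 1                ≡⟨ m+n∸n≡m (m₂ (3 + p)) 1 ⟩
        m₂ (3 + p)                        ∎
        where open ≡-Reasoning
      ... | inner j≤′ = begin
        ψflat₂ p (V₁ !_) (V₂ !_) j  ≡⟨ ψflat₂-inner p (V₁ !_) (V₂ !_) j≤′ ⟩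
        V₂ ! j ∸ 1                  ≡⟨ cong (_∸ 1) (V₂-entry j 1≤j j≤′) ⟩
        m₂ j + 1 ∸ 1                ≡⟨ m+n∸n≡m (m₂ j) 1 ⟩
        m₂ j                        ∎
        where open ≡-Reasoning

      -- g_{1,n} = m_{2,n} + 1 ≥ m_{2,n-1} + 1 = g_{2,n-1}, so Ψ is in its case 3.
      Ψ-recovers : Ψ (3 + p) (V₁ , V₂) ≡ (r₁ , r₂)
      Ψ-recovers = trans (Ψ-flat p V₁ V₂ ψk≡last
          (<ᵇ-no (≤-via (V₂-entry (2 + p) (s≤s z≤n) ≤-refl) V₁-last
                        (+-monoˡ-≤ 1 (mono₂ (2 + p) (s≤s z≤n) ≤-refl)))))
        (cong₂ _,_ (build-ext (2 + p) (V₁ !_) r₁ row₁-recovered)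
                   (build-ext (3 + p) (ψflat₂ p (V₁ !_) (V₂ !_)) r₂ row₂-recovered))

  Φ-isGog : IsGog (3 + p) (Φ (3 + p) (r₁ , r₂))
  Φ-isGog with φCase p r₁ r₂
  ... | bugCase k k≤p bug bugFree eq = subst (IsGog (3 + p)) (sym eq) (BugCase.isGog-Φ k k≤p bug bugFree)
  ... | riseCase bugFree rising eq = subst (IsGog (3 + p)) (sym eq) (NoBug.Rise.isGog-Φ bugFree rising)
  ... | flatCase bugFree flat eq = subst (IsGog (3 + p)) (sym eq) (NoBug.Flat.isGog-Φ bugFree flat)

  Ψ∘Φ≡id : Ψ (3 + p) (Φ (3 + p) (r₁ , r₂)) ≡ (r₁ , r₂)
  Ψ∘Φ≡id with φCase p r₁ r₂
  ... | bugCase k k≤p bug bugFree eq = trans (cong (Ψ (3 + p)) eq) (BugCase.Ψ-recovers k k≤p bug bugFree)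
  ... | riseCase bugFree rising eq = trans (cong (Ψ (3 + p)) eq) (NoBug.Rise.Ψ-recovers bugFree rising)
  ... | flatCase bugFree flat eq = trans (cong (Ψ (3 + p)) eq) (NoBug.Flat.Ψ-recovers bugFree flat)

module OnGog (p : ℕ) (r₁ : Vec ℕ (3 + p)) (r₂ : Vec ℕ (2 + p))
             (ig : IsGog (3 + p) (r₁ , r₂)) where
  open IsGog ig

  g₁ g₂ : ℕ → ℕ
  g₁ = r₁ !_
  g₂ = r₂ !_

  g₁-mono : ∀ i j → 1 ≤ i → i ≤ j → j ≤ 3 + p → g₁ i ≤ g₁ j
  g₁-mono = stepwise-mono g₁ 1 (3 + p) (λ j 1≤j j< → mono₁ j 1≤j (≤-pred j<))

  -- The second row exceeds the (positive) first row, so it is at least 2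
  -- and lowering it by 1 is reversible.
  2≤g₂ : ∀ j → 1 ≤ j → j ≤ 2 + p → 2 ≤ g₂ j
  2≤g₂ j 1≤j j≤ = ≤-<-trans (pos₁ j 1≤j (m≤n⇒m≤1+n j≤)) (col j 1≤j j≤)

  g₂∸1+1 : ∀ j → 1 ≤ j → j ≤ 2 + p → g₂ j ∸ 1 + 1 ≡ g₂ j
  g₂∸1+1 j 1≤j j≤ = m∸n+n≡m (pos₂ j 1≤j j≤)

  g₂-last≤ : g₂ (2 + p) ≤ 3 + p
  g₂-last≤ = <+2⇒≤suc (bnd (2 + p) (s≤s z≤n) ≤-refl)

  -- The diagonal condition g_{1,i+1} ≤ g_{2,i} says that column i is not a
  -- bug once the second row is lowered by 1.
  diag∸1 : ∀ i → 1 ≤ i → i ≤ 2 + p → g₁ (suc i) ≤ suc (g₂ i ∸ 1)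
  diag∸1 i 1≤i i≤ = ≤-trans (diag i 1≤i i≤) (m≤n+m∸n (g₂ i) 1)

  module InnerCase (q : ℕ) (q<p : suc q ≤ p)
                   (passes : g₂ (suc q) ≤ g₁ (3 + q) + 1)
                   (fails : ∀ i → 2 + q < i → i ≤ 2 + p → g₁ (suc i) + 1 < g₂ (i ∸ 1)) where
    k : ℕ
    k = 2 + q

    f₁ f₂ : ℕ → ℕ
    f₁ = ψin₁ k g₁
    f₂ = ψin₂ k g₁ g₂

    k≤1+p : k ≤ 1 + p
    k≤1+p = s≤s q<p

    k≤2+p : k ≤ 2 + p
    k≤2+p = m≤n⇒m≤1+n k≤1+p

    pos₁′ : ∀ j → 1 ≤ j → j ≤ 2 + p → 1 ≤ f₁ j
    pos₁′ j 1≤j j≤ with ≤-<-connex j k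
    ... | inj₁ j≤k = ≤-via refl (ψin₁-upTo k g₁ j≤k) (pos₁ j 1≤j (m≤n⇒m≤1+n j≤))
    ... | inj₂ k<j = ≤-via refl (ψin₁-after k g₁ k<j) (≤-trans (s≤s z≤n) (m≤n+m 2 (g₁ (suc j))))

    pos₂′ : ∀ j → 1 ≤ j → j ≤ 3 + p → 1 ≤ f₂ j
    pos₂′ j 1≤j j≤ with around (suc q) j
    ... | before j≤1+q = ≤-via refl (ψin₂-before (suc q) g₁ g₂ j≤1+q)
                            (2≤⇒1≤∸1 (2≤g₂ j 1≤j (≤-trans j≤1+q (≤-trans (n≤1+n _) k≤2+p))))
    ... | next = ≤-via refl (ψin₂-at (suc q) g₁ g₂) (pos₁ (suc k) (s≤s z≤n) (s≤s k≤2+p))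
    pos₂′ (suc i) 1≤j j≤ | beyond k≤i = ≤-via refl (ψin₂-beyond (suc q) g₁ g₂ k≤i)
                                               (pos₂ i (≤-trans (s≤s z≤n) k≤i) (≤-pred j≤))

    mono₁′ : ∀ j → 1 ≤ j → j ≤ 1 + p → f₁ j ≤ f₁ (suc j)
    mono₁′ j 1≤j j≤ with ≤-<-connex j k
    ... | inj₂ k<j = ≤-via (ψin₁-after k g₁ k<j) (ψin₁-after k g₁ (m≤n⇒m≤1+n k<j))
                           (+-monoˡ-≤ 2 (mono₁ (suc j) (s≤s z≤n) (s≤s j≤)))
    ... | inj₁ j≤k with m≤n⇒m<n∨m≡n j≤k
    ...   | inj₁ j<k  = ≤-via (ψin₁-upTo k g₁ j≤k) (ψin₁-upTo k g₁ j<k) (mono₁ j 1≤j (m≤n⇒m≤1+n j≤))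
    ...   | inj₂ refl = ≤-via (ψin₁-upTo k g₁ j≤k) (ψin₁-after k g₁ ≤-refl)
          (≤-trans (g₁-mono k (2 + k) 1≤j (≤-trans (n≤1+n _) (n≤1+n _)) (s≤s (s≤s j≤))) (m≤m+n _ 2))

    mono₂′ : ∀ j → 1 ≤ j → j ≤ 2 + p → f₂ j ≤ f₂ (suc j)
    mono₂′ j 1≤j j≤ with around (suc q) j
    ... | before j≤1+q with m≤n⇒m<n∨m≡n j≤1+q
    ...   | inj₁ j≤q  = ≤-via (ψin₂-before (suc q) g₁ g₂ j≤1+q) (ψin₂-before (suc q) g₁ g₂ j≤q)
                              (∸-monoˡ-≤ 1 (mono₂ j 1≤j (≤-trans (≤-pred j≤q)
                                                                 (m≤n⇒m≤1+n (≤-trans (n≤1+n _) q<p)))))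
    ...   | inj₂ refl = ≤-via (ψin₂-before (suc q) g₁ g₂ j≤1+q) (ψin₂-at (suc q) g₁ g₂) (≤+1⇒∸1≤ passes)
    mono₂′ j 1≤j j≤ | next = ≤-via (ψin₂-at (suc q) g₁ g₂) (ψin₂-beyond (suc q) g₁ g₂ ≤-refl) (diag k 1≤j j≤)
    mono₂′ (suc i) 1≤j j≤ | beyond k≤i = ≤-via (ψin₂-beyond (suc q) g₁ g₂ k≤i)
      (ψin₂-beyond (suc q) g₁ g₂ (m≤n⇒m≤1+n k≤i)) (mono₂ i (≤-trans (s≤s z≤n) k≤i) (≤-pred j≤))

    col′ : ∀ j → 1 ≤ j → j ≤ 2 + p → f₁ j ≤ f₂ j
    col′ j 1≤j j≤ with around (suc q) j
    ... | before j≤1+q = ≤-via (ψin₁-upTo k g₁ (m≤n⇒m≤1+n j≤1+q)) (ψin₂-before (suc q) g₁ g₂ j≤1+q)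
                               (<⇒≤∸1 (col j 1≤j j≤))
    ... | next = ≤-via (ψin₁-upTo k g₁ ≤-refl) (ψin₂-at (suc q) g₁ g₂) (mono₁ k 1≤j j≤)
    col′ (suc i) 1≤j j≤ | beyond k≤i = ≤-via (ψin₁-after k g₁ (s≤s k≤i)) (ψin₂-beyond (suc q) g₁ g₂ k≤i)
                                              (+1<⇒+2≤ (fails (suc i) (s≤s k≤i) j≤))

    -- At column k the new second row is g_{1,k+1}, and g_{1,k+1} < k because
    -- the test fails at k+1: g_{1,k+2} + 1 < g_{2,k} ≤ k + 1.
    g₁k+1<k : g₁ (suc k) < k
    g₁k+1<k = ≤-<-trans (mono₁ (suc k) (s≤s z≤n) (s≤s k≤1+p))
      (+-cancelʳ-< 1 _ _ (<-≤-trans (fails (suc k) ≤-refl (s≤s k≤1+p))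
                                     (≤-via refl (+1≡suc k) (<+2⇒≤suc (bnd k (s≤s z≤n) k≤2+p)))))

    bnd′ : ∀ j → 1 ≤ j → j ≤ 2 + p → f₂ j ≤ j
    bnd′ j 1≤j j≤ with around (suc q) j
    ... | before j≤1+q = ≤-via (ψin₂-before (suc q) g₁ g₂ j≤1+q) refl (<+2⇒∸1≤ (bnd j 1≤j j≤))
    ... | next = ≤-via (ψin₂-at (suc q) g₁ g₂) refl (<⇒≤ g₁k+1<k)
    bnd′ (suc i) 1≤j j≤ | beyond k≤i = ≤-via (ψin₂-beyond (suc q) g₁ g₂ k≤i) refl
                                              (<+2⇒≤suc (bnd i (≤-trans (s≤s z≤n) k≤i) (m≤n⇒m≤1+n (≤-pred j≤))))

    bndₙ′ : f₂ (3 + p) ≤ 3 + p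
    bndₙ′ = ≤-via (ψin₂-beyond (suc q) g₁ g₂ k≤2+p) refl g₂-last≤

    isMagog-Ψ : IsMagog (3 + p) (build (2 + p) f₁ , build (3 + p) f₂)
    isMagog-Ψ = isMagog-build p f₁ f₂ pos₁′ pos₂′ mono₁′ mono₂′ col′ bnd′ bndₙ′

    -- Φ recovers G from Ψ(G) = (W₁, W₂): its smallest bug is exactly k.
    W₁ : Vec ℕ (2 + p)
    W₁ = build (2 + p) f₁
    W₂ : Vec ℕ (3 + p)
    W₂ = build (3 + p) f₂

    W₂-at-k : W₂ ! k ≡ g₁ (suc k)
    W₂-at-k = trans (!-build (3 + p) f₂ k (s≤s z≤n) (m≤n⇒m≤1+n k≤2+p)) (ψin₂-at (suc q) g₁ g₂)

    -- Column k is a bug: g_{1,k+1} + 1 < g_{1,k+2} + 2.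
    bug-at-k : bugTest W₁ W₂ k ≡ true
    bug-at-k = <ᵇ-yes (<-via (cong suc W₂-at-k)
      (trans (!-build (2 + p) f₁ (suc k) (s≤s z≤n) (s≤s k≤1+p)) (ψin₁-after k g₁ ≤-refl))
      (≤⇒suc<+2 (mono₁ (suc k) (s≤s z≤n) (s≤s k≤1+p))))

    -- Columns before k are no bugs, by the diagonal condition of G.
    no-bug-before-k : ∀ i → 1 ≤ i → i < k → bugTest W₁ W₂ i ≡ false
    no-bug-before-k i 1≤i i<k = <ᵇ-no (≤-via
      (trans (!-build (2 + p) f₁ (suc i) (s≤s z≤n) (≤-trans i<k k≤2+p)) (ψin₁-upTo k g₁ i<k))
      (cong suc (trans (!-build (3 + p) f₂ i 1≤i (≤-trans (<⇒≤ i<k) (≤-trans k≤2+p (n≤1+n _))))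
                       (ψin₂-before (suc q) g₁ g₂ (≤-pred i<k))))
      (diag∸1 i 1≤i (≤-trans (<⇒≤ i<k) k≤2+p)))

    smallestBug≡k : smallestBug (3 + p) (W₁ , W₂) ≡ just k
    smallestBug≡k = first-finds (bugTest W₁ W₂) 1 (suc p) k bug-at-k (s≤s z≤n) (s≤s k≤1+p) no-bug-before-k

    row₁-recovered : ∀ j → 1 ≤ j → j ≤ 3 + p → φbug₁ k (W₁ !_) (W₂ !_) j ≡ r₁ ! j
    row₁-recovered j 1≤j j≤ with around k j
    ... | before j≤k = begin
      φbug₁ k (W₁ !_) (W₂ !_) j  ≡⟨ φbug₁-before k (W₁ !_) (W₂ !_) j≤k ⟩
      W₁ ! j                     ≡⟨ !-build (2 + p) f₁ j 1≤j (≤-trans j≤k k≤2+p) ⟩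
      f₁ j                       ≡⟨ ψin₁-upTo k g₁ j≤k ⟩
      g₁ j                       ∎
      where open ≡-Reasoning
    ... | next = trans (φbug₁-next k (W₁ !_) (W₂ !_)) W₂-at-k
    row₁-recovered (suc i) 1≤j j≤ | beyond k<i = begin
      φbug₁ k (W₁ !_) (W₂ !_) (suc i)  ≡⟨ φbug₁-beyond k (W₁ !_) (W₂ !_) k<i ⟩
      W₁ ! i ∸ 2                       ≡⟨ cong (_∸ 2) (!-build (2 + p) f₁ i (≤-trans (s≤s z≤n) k<i) (≤-pred j≤)) ⟩
      f₁ i ∸ 2                         ≡⟨ cong (_∸ 2) (ψin₁-after k g₁ k<i) ⟩
      g₁ (suc i) + 2 ∸ 2               ≡⟨ m+n∸n≡m (g₁ (suc i)) 2 ⟩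
      g₁ (suc i)                       ∎
      where open ≡-Reasoning

    row₂-recovered : ∀ j → 1 ≤ j → j ≤ 2 + p → φbug₂ k (W₂ !_) j ≡ r₂ ! j
    row₂-recovered j 1≤j j≤ with ≤-<-connex j (suc q)
    ... | inj₁ j≤1+q = begin
      φbug₂ k (W₂ !_) j  ≡⟨ φbug₂-before (suc q) (W₂ !_) j≤1+q ⟩
      W₂ ! j + 1         ≡⟨ cong (_+ 1) (!-build (3 + p) f₂ j 1≤j (m≤n⇒m≤1+n j≤)) ⟩
      f₂ j + 1           ≡⟨ cong (_+ 1) (ψin₂-before (suc q) g₁ g₂ j≤1+q) ⟩
      g₂ j ∸ 1 + 1       ≡⟨ g₂∸1+1 j 1≤j j≤ ⟩
      g₂ j               ∎
      where open ≡-Reasoning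
    ... | inj₂ 1+q<j = begin
      φbug₂ k (W₂ !_) j  ≡⟨ φbug₂-from (suc q) (W₂ !_) 1+q<j ⟩
      W₂ ! suc j         ≡⟨ !-build (3 + p) f₂ (suc j) (s≤s z≤n) (s≤s j≤) ⟩
      f₂ (suc j)         ≡⟨ ψin₂-beyond (suc q) g₁ g₂ 1+q<j ⟩
      g₂ j               ∎
      where open ≡-Reasoning

    Φ-recovers : Φ (3 + p) (W₁ , W₂) ≡ (r₁ , r₂)
    Φ-recovers = trans (Φ-bug (3 + p) W₁ W₂ k smallestBug≡k)
      (cong₂ _,_ (build-ext (3 + p) (φbug₁ k (W₁ !_) (W₂ !_)) r₁ row₁-recovered)
                 (build-ext (2 + p) (φbug₂ k (W₂ !_)) r₂ row₂-recovered))

  W₁ : Vec ℕ (2 + p)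
  W₁ = build (2 + p) g₁

  W₁-entry : ∀ j → 1 ≤ j → j ≤ 2 + p → W₁ ! j ≡ g₁ j
  W₁-entry = !-build (2 + p) g₁

  no-bug-with-W₁ : (W₂ : Vec ℕ (3 + p)) → (∀ i → 1 ≤ i → i ≤ 1 + p → W₂ ! i ≡ g₂ i ∸ 1) →
    smallestBug (3 + p) (W₁ , W₂) ≡ nothing
  no-bug-with-W₁ W₂ W₂-entry = first-fails (bugTest W₁ W₂) 1 (suc p) (λ i 1≤i i< → <ᵇ-no (≤-via
    (W₁-entry (suc i) (s≤s z≤n) i<) (cong suc (W₂-entry i 1≤i (≤-pred i<)))
    (diag∸1 i 1≤i (m≤n⇒m≤1+n (≤-pred i<)))))

  module RiseCase (rising : g₁ (3 + p) < g₂ (2 + p)) (passes : g₂ (1 + p) ≤ g₁ (3 + p) + 1) where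
    f₂ : ℕ → ℕ
    f₂ = ψrise₂ p g₁ g₂

    pos₁′ : ∀ j → 1 ≤ j → j ≤ 2 + p → 1 ≤ g₁ j
    pos₁′ j 1≤j j≤ = pos₁ j 1≤j (m≤n⇒m≤1+n j≤)

    pos₂′ : ∀ j → 1 ≤ j → j ≤ 3 + p → 1 ≤ f₂ j
    pos₂′ j 1≤j j≤ with upTo (2 + p) j j≤
    ... | last = ≤-via refl (ψrise₂-last p g₁ g₂) (pos₂ (2 + p) (s≤s z≤n) ≤-refl)
    ... | inner j≤2+p with upTo (1 + p) j j≤2+p
    ...   | inner j≤1+p = ≤-via refl (ψrise₂-inner p g₁ g₂ j≤1+p) (2≤⇒1≤∸1 (2≤g₂ j 1≤j j≤2+p))
    ...   | last        = ≤-via refl (ψrise₂-penultimate p g₁ g₂) (pos₁ (3 + p) (s≤s z≤n) ≤-refl)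

    mono₁′ : ∀ j → 1 ≤ j → j ≤ 1 + p → g₁ j ≤ g₁ (suc j)
    mono₁′ j 1≤j j≤ = mono₁ j 1≤j (m≤n⇒m≤1+n j≤)

    mono₂′ : ∀ j → 1 ≤ j → j ≤ 2 + p → f₂ j ≤ f₂ (suc j)
    mono₂′ j 1≤j j≤ with upTo (1 + p) j j≤
    ... | last = ≤-via (ψrise₂-penultimate p g₁ g₂) (ψrise₂-last p g₁ g₂) (<⇒≤ rising)
    ... | inner j≤1+p with upTo p j j≤1+p
    ...   | inner j≤p = ≤-via (ψrise₂-inner p g₁ g₂ j≤1+p) (ψrise₂-inner p g₁ g₂ (s≤s j≤p))
                              (∸-monoˡ-≤ 1 (mono₂ j 1≤j j≤1+p))
    ...   | last      = ≤-via (ψrise₂-inner p g₁ g₂ j≤1+p) (ψrise₂-penultimate p g₁ g₂) (≤+1⇒∸1≤ passes)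

    col′ : ∀ j → 1 ≤ j → j ≤ 2 + p → g₁ j ≤ f₂ j
    col′ j 1≤j j≤ with upTo (1 + p) j j≤
    ... | last        = ≤-via refl (ψrise₂-penultimate p g₁ g₂) (mono₁ (2 + p) 1≤j ≤-refl)
    ... | inner j≤1+p = ≤-via refl (ψrise₂-inner p g₁ g₂ j≤1+p) (<⇒≤∸1 (col j 1≤j j≤))

    bnd′ : ∀ j → 1 ≤ j → j ≤ 2 + p → f₂ j ≤ j
    bnd′ j 1≤j j≤ with upTo (1 + p) j j≤
    ... | last        = ≤-via (ψrise₂-penultimate p g₁ g₂) refl (≤-pred (<-≤-trans rising g₂-last≤))
    ... | inner j≤1+p = ≤-via (ψrise₂-inner p g₁ g₂ j≤1+p) refl (<+2⇒∸1≤ (bnd j 1≤j j≤))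

    bndₙ′ : f₂ (3 + p) ≤ 3 + p
    bndₙ′ = ≤-via (ψrise₂-last p g₁ g₂) refl g₂-last≤

    isMagog-Ψ : IsMagog (3 + p) (build (2 + p) g₁ , build (3 + p) f₂)
    isMagog-Ψ = isMagog-build p g₁ f₂ pos₁′ pos₂′ mono₁′ mono₂′ col′ bnd′ bndₙ′

    W₂ : Vec ℕ (3 + p)
    W₂ = build (3 + p) f₂

    W₂-penultimate : W₂ ! (2 + p) ≡ g₁ (3 + p)
    W₂-penultimate = trans (!-build (3 + p) f₂ (2 + p) (s≤s z≤n) (n≤1+n _)) (ψrise₂-penultimate p g₁ g₂)

    W₂-last : W₂ ! (3 + p) ≡ g₂ (2 + p)
    W₂-last = trans (!-build (3 + p) f₂ (3 + p) (s≤s z≤n) ≤-refl) (ψrise₂-last p g₁ g₂)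

    W₂-inner : ∀ i → 1 ≤ i → i ≤ 1 + p → W₂ ! i ≡ g₂ i ∸ 1
    W₂-inner i 1≤i i≤ = trans (!-build (3 + p) f₂ i 1≤i (≤-trans i≤ (≤-trans (n≤1+n _) (n≤1+n _))))
                              (ψrise₂-inner p g₁ g₂ i≤)

    row₁-recovered : ∀ j → 1 ≤ j → j ≤ 3 + p → φrise₁ p (W₁ !_) (W₂ !_) j ≡ r₁ ! j
    row₁-recovered j 1≤j j≤ with upTo (2 + p) j j≤
    ... | inner j≤2+p = trans (φrise₁-inner p (W₁ !_) (W₂ !_) j≤2+p) (W₁-entry j 1≤j j≤2+p)
    ... | last        = trans (φrise₁-last p (W₁ !_) (W₂ !_)) W₂-penultimate

    row₂-recovered : ∀ j → 1 ≤ j → j ≤ 2 + p → φrise₂ p (W₂ !_) j ≡ r₂ ! j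
    row₂-recovered j 1≤j j≤ with upTo (1 + p) j j≤
    ... | last        = trans (φrise₂-last p (W₂ !_)) W₂-last
    ... | inner j≤1+p = begin
      φrise₂ p (W₂ !_) j  ≡⟨ φrise₂-inner p (W₂ !_) j≤1+p ⟩
      W₂ ! j + 1          ≡⟨ cong (_+ 1) (W₂-inner j 1≤j j≤1+p) ⟩
      g₂ j ∸ 1 + 1        ≡⟨ g₂∸1+1 j 1≤j j≤ ⟩
      g₂ j                ∎
      where open ≡-Reasoning

    Φ-recovers : Φ (3 + p) (W₁ , W₂) ≡ (r₁ , r₂)
    Φ-recovers = trans (Φ-rise p W₁ W₂ (no-bug-with-W₁ W₂ W₂-inner)
                                 (<ᵇ-yes (<-via W₂-penultimate W₂-last rising)))
      (cong₂ _,_ (build-ext (3 + p) (φrise₁ p (W₁ !_) (W₂ !_)) r₁ row₁-recovered)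
                 (build-ext (2 + p) (φrise₂ p (W₂ !_)) r₂ row₂-recovered))

  module FlatCase (flat : g₂ (2 + p) ≤ g₁ (3 + p)) where
    f₂ : ℕ → ℕ
    f₂ = ψflat₂ p g₁ g₂

    pos₁′ : ∀ j → 1 ≤ j → j ≤ 2 + p → 1 ≤ g₁ j
    pos₁′ j 1≤j j≤ = pos₁ j 1≤j (m≤n⇒m≤1+n j≤)

    pos₂′ : ∀ j → 1 ≤ j → j ≤ 3 + p → 1 ≤ f₂ j
    pos₂′ j 1≤j j≤ with upTo (2 + p) j j≤
    ... | last        = ≤-via refl (ψflat₂-last p g₁ g₂)
                              (2≤⇒1≤∸1 (≤-trans (2≤g₂ (2 + p) (s≤s z≤n) ≤-refl) flat))
    ... | inner j≤2+p = ≤-via refl (ψflat₂-inner p g₁ g₂ j≤2+p) (2≤⇒1≤∸1 (2≤g₂ j 1≤j j≤2+p))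

    mono₁′ : ∀ j → 1 ≤ j → j ≤ 1 + p → g₁ j ≤ g₁ (suc j)
    mono₁′ j 1≤j j≤ = mono₁ j 1≤j (m≤n⇒m≤1+n j≤)

    mono₂′ : ∀ j → 1 ≤ j → j ≤ 2 + p → f₂ j ≤ f₂ (suc j)
    mono₂′ j 1≤j j≤ with upTo (1 + p) j j≤
    ... | last        = ≤-via (ψflat₂-inner p g₁ g₂ j≤) (ψflat₂-last p g₁ g₂) (∸-monoˡ-≤ 1 flat)
    ... | inner j≤1+p = ≤-via (ψflat₂-inner p g₁ g₂ j≤) (ψflat₂-inner p g₁ g₂ (s≤s j≤1+p))
                              (∸-monoˡ-≤ 1 (mono₂ j 1≤j j≤1+p))

    col′ : ∀ j → 1 ≤ j → j ≤ 2 + p → g₁ j ≤ f₂ j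
    col′ j 1≤j j≤ = ≤-via refl (ψflat₂-inner p g₁ g₂ j≤) (<⇒≤∸1 (col j 1≤j j≤))

    bnd′ : ∀ j → 1 ≤ j → j ≤ 2 + p → f₂ j ≤ j
    bnd′ j 1≤j j≤ = ≤-via (ψflat₂-inner p g₁ g₂ j≤) refl (<+2⇒∸1≤ (bnd j 1≤j j≤))

    -- g_{1,n} - 1 < g_{1,n} ≤ g_{2,n-1} ≤ n by the diagonal condition.
    bndₙ′ : f₂ (3 + p) ≤ 3 + p
    bndₙ′ = ≤-via (ψflat₂-last p g₁ g₂) refl
      (≤-trans (m∸n≤m _ 1) (≤-trans (diag (2 + p) (s≤s z≤n) ≤-refl) g₂-last≤))

    isMagog-Ψ : IsMagog (3 + p) (build (2 + p) g₁ , build (3 + p) f₂)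
    isMagog-Ψ = isMagog-build p g₁ f₂ pos₁′ pos₂′ mono₁′ mono₂′ col′ bnd′ bndₙ′

    W₂ : Vec ℕ (3 + p)
    W₂ = build (3 + p) f₂

    W₂-inner : ∀ i → 1 ≤ i → i ≤ 2 + p → W₂ ! i ≡ g₂ i ∸ 1
    W₂-inner i 1≤i i≤ = trans (!-build (3 + p) f₂ i 1≤i (m≤n⇒m≤1+n i≤)) (ψflat₂-inner p g₁ g₂ i≤)

    W₂-last : W₂ ! (3 + p) ≡ g₁ (3 + p) ∸ 1
    W₂-last = trans (!-build (3 + p) f₂ (3 + p) (s≤s z≤n) ≤-refl) (ψflat₂-last p g₁ g₂)

    row₁-recovered : ∀ j → 1 ≤ j → j ≤ 3 + p → φflat₁ p (W₁ !_) (W₂ !_) j ≡ r₁ ! j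
    row₁-recovered j 1≤j j≤ with upTo (2 + p) j j≤
    ... | inner j≤2+p = trans (φflat₁-inner p (W₁ !_) (W₂ !_) j≤2+p) (W₁-entry j 1≤j j≤2+p)
    ... | last = begin
      φflat₁ p (W₁ !_) (W₂ !_) (3 + p)  ≡⟨ φflat₁-last p (W₁ !_) (W₂ !_) ⟩
      W₂ ! (3 + p) + 1                  ≡⟨ cong (_+ 1) W₂-last ⟩
      g₁ (3 + p) ∸ 1 + 1                ≡⟨ m∸n+n≡m (pos₁ (3 + p) (s≤s z≤n) ≤-refl) ⟩
      g₁ (3 + p)                        ∎
      where open ≡-Reasoning

    row₂-recovered : ∀ j → 1 ≤ j → j ≤ 2 + p → φflat₂ (W₂ !_) j ≡ r₂ ! j
    row₂-recovered j 1≤j j≤ = trans (cong (_+ 1) (W₂-inner j 1≤j j≤)) (g₂∸1+1 j 1≤j j≤)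

    -- W₂ ends with g_{2,n-1} - 1 ≥ g_{1,n} - 1, so Φ is in its case 3.
    Φ-recovers : Φ (3 + p) (W₁ , W₂) ≡ (r₁ , r₂)
    Φ-recovers = trans (Φ-flat p W₁ W₂
          (no-bug-with-W₁ W₂ (λ i 1≤i i≤ → W₂-inner i 1≤i (m≤n⇒m≤1+n i≤)))
          (<ᵇ-no (≤-via W₂-last (W₂-inner (2 + p) (s≤s z≤n) ≤-refl)
                        (∸-monoˡ-≤ 1 (diag (2 + p) (s≤s z≤n) ≤-refl)))))
      (cong₂ _,_ (build-ext (3 + p) (φflat₁ p (W₁ !_) (W₂ !_)) r₁ row₁-recovered)
                 (build-ext (2 + p) (φflat₂ (W₂ !_)) r₂ row₂-recovered))

  Ψ-isMagog : IsMagog (3 + p) (Ψ (3 + p) (r₁ , r₂))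
  Ψ-isMagog with ψCase p r₁ r₂ ig
  ... | innerCase q q<p passes fails eq = subst (IsMagog (3 + p)) (sym eq) (InnerCase.isMagog-Ψ q q<p passes fails)
  ... | riseCase rising passes eq = subst (IsMagog (3 + p)) (sym eq) (RiseCase.isMagog-Ψ rising passes)
  ... | flatCase flat eq = subst (IsMagog (3 + p)) (sym eq) (FlatCase.isMagog-Ψ flat)

  Φ∘Ψ≡id : Φ (3 + p) (Ψ (3 + p) (r₁ , r₂)) ≡ (r₁ , r₂)
  Φ∘Ψ≡id with ψCase p r₁ r₂ ig
  ... | innerCase q q<p passes fails eq = trans (cong (Φ (3 + p)) eq) (InnerCase.Φ-recovers q q<p passes fails)
  ... | riseCase rising passes eq = trans (cong (Φ (3 + p)) eq) (RiseCase.Φ-recovers rising passes)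
  ... | flatCase flat eq = trans (cong (Φ (3 + p)) eq) (FlatCase.Φ-recovers flat)

mainTheorem1 : (n : ℕ) → 3 ≤ n →
    ((M : Magog n) → IsMagog n M → IsGog n (Φ n M)) ×
    ((G : Gog n) → IsGog n G → IsMagog n (Ψ n G)) ×
    ((M : Magog n) → IsMagog n M → Ψ n (Φ n M) ≡ M) ×
    ((G : Gog n) → IsGog n G → Φ n (Ψ n G) ≡ G)
mainTheorem1 (suc (suc (suc p))) _ =
  (λ { (r₁ , r₂) im → OnMagog.Φ-isGog p r₁ r₂ im }) ,
  (λ { (r₁ , r₂) ig → OnGog.Ψ-isMagog p r₁ r₂ ig }) ,
  (λ { (r₁ , r₂) im → OnMagog.Ψ∘Φ≡id p r₁ r₂ im }) ,
  (λ { (r₁ , r₂) ig → OnGog.Φ∘Ψ≡id p r₁ r₂ ig })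
mainTheorem1 (suc (suc zero)) (s≤s (s≤s ()))
mainTheorem1 (suc zero) (s≤s ())
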